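{- Let $\mathcal{A}$ be a finite abelian group and $m$ a positive integer. Then the number $\mathcal{E}(\mathcal{A},m)$ of equivalence classes of Cayley graphs $C(\mathcal{A},\Omega)$ of degree $m$ is $$\mathcal{E}(\mathcal{A},m)=\sum_{k=0}^{\lfloor m/2\rfloor}\sum_{\mathcal{S}\le\mathcal{A}}\mu(\mathcal{S})\binom{\frac12(|\mathcal{S}|-|O_2(\mathcal{S})|-1)}{k}\binom{|O_2(\mathcal{S})|}{m-2k},$$ where $O_2(\mathcal{S})=\{g\in\mathcal{S}: g^2=e,\ g\neq e\}$. In particular, if $|\mathcal{A}|$ is odd, then $$\mathcal{E}(\mathcal{A},m)=\begin{cases}\sum_{\mathcal{S}\le\mathcal{A}}\mu(\mathcal{S})\binom{\frac12(|\mathcal{S}|-1)}{m/2} & \text{if $m$ is even},\\ 0&\text{if $m$ is odd.}\end{cases}$$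
   Context: For a finite group $\mathcal{A}$ with identity $e$ and $\Omega\subseteq\mathcal{A}$ generating $\mathcal{A}$ with $\Omega=\Omega^{ -1}$, $e\notin\Omega$, the Cayley graph $C(\mathcal{A},\Omega)$ has vertex set $\mathcal{A}$ and edges $\{g,h\}$ with $g^{ -1}h\in\Omega$; its degree is $|\Omega|$. $\mathcal{A}$ acts on it by left multiplication. A graph isomorphism $f:C(\mathcal{A},\Omega)\to C(\mathcal{A},\Omega')$ is an equivalence if $f(gu)=gf(u)$ for all $g,u\in\mathcal{A}$. $\mu$ is the Möbius function on the subgroup lattice of $\mathcal{A}$ relative to the top element, defined recursively by $\sum_{\mathcal{S}'\ge\mathcal{S}}\mu(\mathcal{S}')=1$ if $\mathcal{S}=\mathcal{A}$ and $0$ if $\mathcal{S}<\mathcal{A}$. Binomial coefficients $\binom{a}{b}$ are $0$ when $b>a$. -}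

module Defs where

open import Data.Nat using (ℕ; zero; suc; _∸_; _*_; _/_)
open import Data.Nat.Combinatorics using (_C_)
open import Data.Integer as ℤ using (ℤ; +_)
open import Data.Fin using (Fin; _≟_)
open import Data.Fin.Subset using (Subset; inside; outside; _∈_; _∉_; _⊆_; ⊤; ∣_∣)
open import Data.Fin.Subset.Properties using (_∈?_; _⊆?_)
open import Data.Fin.Properties using (all?)
open import Data.List using (List; []; _∷_; [_]; _++_; map; filter; length; allFin; upTo; foldr)
open import Data.List.Relation.Unary.All using (All)
open import Data.List.Relation.Unary.Any using (Any)
open import Data.List.Relation.Unary.AllPairs using (AllPairs)
open import Data.Vec using (_∷_; [])
open import Data.Product using (Σ; _×_)
open import Function.Bundles using (_⤖_; Bijection)
open import Relation.Nullary using (¬_; Dec; ¬?)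
open import Relation.Nullary.Decidable using (_×-dec_; _→-dec_)
open import Relation.Binary.PropositionalEquality using (_≡_; _≢_)
open import Algebra.Structures using (IsAbelianGroup)

-- A finite abelian group of order n, on the carrier Fin n
-- (every finite group is isomorphic to one of this form).

record FinAbGroup (n : ℕ) : Set where
  infixl 7 _∙_
  infix  8 _⁻¹
  field
    _∙_            : Fin n → Fin n → Fin n
    ε              : Fin n
    _⁻¹            : Fin n → Fin n
    isAbelianGroup : IsAbelianGroup _≡_ _∙_ ε _⁻¹

allSubsets : ∀ n → List (Subset n)
allSubsets zero    = [ [] ]
allSubsets (suc n) = map (inside ∷_) (allSubsets n) ++ map (outside ∷_) (allSubsets n)

sumℤ : List ℤ → ℤ
sumℤ = foldr ℤ._+_ (+ 0)

module _ {n : ℕ} (G : FinAbGroup n) where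
  open FinAbGroup G

  IsSubgroup : Subset n → Set
  IsSubgroup S = (ε ∈ S)
               × (∀ x → ∀ y → x ∈ S → y ∈ S → (x ∙ y) ∈ S)
               × (∀ x → x ∈ S → (x ⁻¹) ∈ S)

  isSubgroup? : (S : Subset n) → Dec (IsSubgroup S)
  isSubgroup? S = (ε ∈? S)
    ×-dec all? (λ x → all? (λ y → (x ∈? S) →-dec ((y ∈? S) →-dec ((x ∙ y) ∈? S))))
    ×-dec all? (λ x → (x ∈? S) →-dec ((x ⁻¹) ∈? S))

  subgroups : List (Subset n)
  subgroups = filter isSubgroup? (allSubsets n)

  upSum : (Subset n → ℤ) → Subset n → ℤ
  upSum μ S = sumℤ (map μ (filter (S ⊆?_) subgroups))

  -- μ is the Möbius function of the subgroup lattice relative to the top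
  -- element, via its defining recursion (which determines μ on subgroups).
  IsMobius : (Subset n → ℤ) → Set
  IsMobius μ = (upSum μ ⊤ ≡ + 1)
             × (∀ S → IsSubgroup S → S ≢ ⊤ → upSum μ S ≡ + 0)

  o₂ : Subset n → ℕ
  o₂ S = length (filter (λ g → (g ∈? S) ×-dec ((g ∙ g) ≟ ε) ×-dec ¬? (g ≟ ε)) (allFin n))

  Generates : Subset n → Set
  Generates Ω = ∀ S → IsSubgroup S → Ω ⊆ S → ∀ g → g ∈ S

  IsConnectionSet : Subset n → Set
  IsConnectionSet Ω = (∀ g → g ∈ Ω → (g ⁻¹) ∈ Ω) × (ε ∉ Ω) × Generates Ω

  Adj : Subset n → Fin n → Fin n → Set
  Adj Ω g h = (g ⁻¹ ∙ h) ∈ Ω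

  Equivalent : Subset n → Subset n → Set
  Equivalent Ω Ω′ = Σ (Fin n ⤖ Fin n) λ b →
    let f = Bijection.to b in
      (∀ g h → (Adj Ω g h → Adj Ω′ (f g) (f h)) × (Adj Ω′ (f g) (f h) → Adj Ω g h))
    × (∀ g u → f (g ∙ u) ≡ g ∙ f u)

  -- "the number of equivalence classes of Cayley graphs C(A,Ω) of degree m is N":
  -- there is a complete list of pairwise inequivalent representatives of length N.
  NumClasses : ℕ → ℤ → Set
  NumClasses m N = Σ (List (Subset n)) λ L →
      All (λ Ω → IsConnectionSet Ω × ∣ Ω ∣ ≡ m) L
    × AllPairs (λ Ω Ω′ → ¬ Equivalent Ω Ω′) L
    × (∀ Ω → IsConnectionSet Ω → ∣ Ω ∣ ≡ m → Any (Equivalent Ω) L)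
    × (+ length L ≡ N)

  formula : (Subset n → ℤ) → ℕ → ℤ
  formula μ m = sumℤ (map (λ k → sumℤ (map (λ S →
      μ S ℤ.* + ((((∣ S ∣ ∸ o₂ S ∸ 1) / 2) C k) * (o₂ S C (m ∸ 2 * k))))
      subgroups)) (upTo (suc (m / 2))))

  formulaOdd : (Subset n → ℤ) → ℕ → ℤ
  formulaOdd μ m = sumℤ (map (λ S → μ S ℤ.* + (((∣ S ∣ ∸ 1) / 2) C (m / 2))) subgroups)

module Submission where

open import Defs
open import Data.Nat
  using (ℕ; zero; suc; _+_; _*_; _∸_; _/_; _%_; _≤_; _<_; z≤n; s≤s; z<s; s<s)
open import Data.Integer using (ℤ; +_) renaming (_+_ to _+ℤ_; _*_ to _*ℤ_)
open import Data.Fin.Subset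
  using (Subset; inside; outside; _∈_; _∉_; _⊆_; ⊥; ⊤; ∣_∣; _∩_; Nonempty)
open import Data.Product using (_×_; _,_; proj₁; proj₂)
open import Relation.Binary.PropositionalEquality
open ≡-Reasoning

open import Algebra.Bundles using (Group)
open import Algebra.Structures using (IsAbelianGroup)
import Algebra.Properties.Group as GroupProperties
open import Data.Bool.Base using (true; if_then_else_)
open import Data.Empty using (⊥-elim)
open import Data.Nat.Properties
  using ( _≟_; _≤?_; ≤-trans; ≤-reflexive; ≤-pred; <⇒≱; n≮n; ≰⇒>; m≤m+n; m≤n⇒m≤1+n; n≤1+n
        ; m<n⇒m<1+n; <-≤-trans; ≤∧≢⇒<; n≤0⇒n≡0; suc-injective; 1+n≢0; 0≢1+n
        ; +-identityʳ; +-suc; *-comm; *-suc; *-identityʳ; *-zeroʳ; *-monoʳ-≤; *-monoʳ-<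
        ; *-distribˡ-+; *-distribʳ-+; +-∸-assoc; m≤n⇒m∸n≡0; m<n⇒0<n∸m; m+n∸n≡m; n∸n≡0
        ; +-commutativeSemigroup )
open import Algebra.Properties.CommutativeSemigroup +-commutativeSemigroup
  using (interchange; x∙yz≈y∙xz)
open import Data.Nat.DivMod
  using (m*n/n≡m; m/n*n≤m; m/n≤m; /-monoˡ-≤; m≡m%n+[m/n]*n; m*n%n≡0)
open import Data.Nat.Combinatorics using (_C_; nCk+nC[k+1]≡[n+1]C[k+1]; k>n⇒nCk≡0)
open import Data.Nat.Induction using (<-rec)
open import Data.Nat.ListAction using (sum)
open import Data.Nat.ListAction.Properties using (sum-++)
open import Data.Integer.Properties as ℤ using ()
open import Algebra.Properties.CommutativeSemigroup ℤ.+-commutativeSemigroup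
  using () renaming (interchange to +ℤ-interchange)
open import Algebra.Properties.CommutativeSemigroup ℤ.*-commutativeSemigroup
  using () renaming (x∙yz≈z∙yx to *ℤ-x∙yz≈z∙yx)
open import Data.Fin.Base using (Fin; zero; suc)
import Data.Fin.Properties as Fin
open import Data.Fin.Subset.Properties
  using ( _∈?_; _⊆?_; ⊆-antisym; ⊆-trans; ∈⊤; ∉⊥; ∣⊥∣≡0; ∣⊤∣≡n; x∈p∩q⁺; x∈p∩q⁻; ∣p∩q∣≤∣p∣
        ; Empty-unique; ⊆-min )
open import Data.List.Base as List
  using (List; []; _∷_; map; filter; length; _++_; allFin; applyUpTo; upTo)
open import Data.List.Properties
  using (map-applyUpTo; map-cong; map-cong-local; map-++; map-∘; filter-none)
import Data.List.Membership.Propositional as List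
open import Data.List.Membership.Propositional.Properties
  using (∈-filter⁺; ∈-filter⁻; ∈-map⁺; ∈-map⁻; ∈-++⁺ˡ; ∈-++⁺ʳ)
open import Data.List.Relation.Unary.All as All using (All)
open import Data.List.Relation.Unary.All.Properties using (all-filter)
open import Data.List.Relation.Unary.Any as Any using (here)
import Data.List.Relation.Unary.AllPairs as AllPairs
import Data.List.Relation.Unary.AllPairs.Properties as AllPairs
import Data.List.Relation.Unary.Unique.Propositional as Unique
import Data.List.Relation.Unary.Unique.Propositional.Properties as Unique
open import Data.Vec.Base as Vec using ([]; _∷_; _[_]≔_; here; there; tabulate)
open import Data.Vec.Properties using ([]≔-minimal; lookup⇒[]=; []=⇒lookup; lookup∘tabulate)
open import Data.Product.Function.NonDependent.Propositional using (_×-⇔_)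
open import Data.Sum.Base as Sum using (_⊎_; inj₁; inj₂; [_,_]′)
open import Function.Base using (_∘_)
open import Function.Bundles using (_⇔_; mk⇔; Equivalence; Bijection)
open import Function.Construct.Composition using (_⇔-∘_)
open import Function.Construct.Identity using (⤖-id; ⇔-id)
open import Relation.Nullary using (Dec; yes; no; does; ¬_; ¬?; contradiction)
open import Relation.Nullary.Decidable using (_×-dec_; _→-dec_; map′; dec-true; dec-false)
open import Relation.Unary using (Pred; Decidable)

-- An equivalence C(A, Ω) → C(A, Ω′) is equivariant, hence a translation u ↦ u a; since A is
-- abelian it maps the neighbourhood Ω of e onto Ω′, so Ω = Ω′ and the classes of degree m are
-- just the connection sets of size m.  These are the inverse-closed m-subsets of A ∖ {e} that
-- generate A, and Möbius inversion over the subgroup lattice trades generating A for lying in a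
-- subgroup S.  Inversion is an involution of S ∖ {e} whose fixed points form O₂(S) and whose
-- other orbits are the (|S| − |O₂(S)| − 1)/2 pairs {g, g⁻¹}; a closed m-subset consists of k such
-- pairs and m − 2k fixed points.  If |A| is odd there are no involutions h, for g ↦ g h would be
-- a fixed-point-free involution of A; so then O₂(S) = ∅.

private
  variable
    n k : ℕ

-- Truncated binomial convolutions

sumBelow : ℕ → (ℕ → ℕ) → ℕ
sumBelow B f = sum (applyUpTo f B)

sumBelow-cong : ∀ B {f g : ℕ → ℕ} → (∀ {k} → k < B → f k ≡ g k) →
                sumBelow B f ≡ sumBelow B g
sumBelow-cong zero    eq = refl
sumBelow-cong (suc B) eq = cong₂ _+_ (eq z<s) (sumBelow-cong B (eq ∘ s<s))

sumBelow-zero : ∀ B {f : ℕ → ℕ} → (∀ {k} → k < B → f k ≡ 0) → sumBelow B f ≡ 0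
sumBelow-zero zero    vanish = refl
sumBelow-zero (suc B) vanish = cong₂ _+_ (vanish z<s) (sumBelow-zero B (vanish ∘ s<s))

sumBelow-+ : ∀ B (f g : ℕ → ℕ) →
             sumBelow B (λ k → f k + g k) ≡ sumBelow B f + sumBelow B g
sumBelow-+ zero    f g = refl
sumBelow-+ (suc B) f g = begin
  f 0 + g 0 + sumBelow B (λ k → f (suc k) + g (suc k))
    ≡⟨ cong (λ s → f 0 + g 0 + s) (sumBelow-+ B (f ∘ suc) (g ∘ suc)) ⟩
  f 0 + g 0 + (sumBelow B (f ∘ suc) + sumBelow B (g ∘ suc))
    ≡⟨ interchange (f 0) (g 0) _ _ ⟩
  sumBelow (suc B) f + sumBelow (suc B) g ∎

sumBelow-vanishing : ∀ {B B′} (f : ℕ → ℕ) → B ≤ B′ → (∀ {k} → B ≤ k → f k ≡ 0) →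
                     sumBelow B′ f ≡ sumBelow B f
sumBelow-vanishing {B′ = B′} f z≤n        vanish = sumBelow-zero B′ (λ _ → vanish z≤n)
sumBelow-vanishing           f (s≤s B≤B′) vanish =
  cong (λ s → f 0 + s) (sumBelow-vanishing (f ∘ suc) B≤B′ (vanish ∘ s≤s))

sumBelow-last : ∀ B (f : ℕ → ℕ) → (∀ {k} → k < B → f k ≡ 0) → sumBelow (suc B) f ≡ f B
sumBelow-last zero    f vanish = +-identityʳ (f 0)
sumBelow-last (suc B) f vanish = trans (cong (_+ sumBelow (suc B) (f ∘ suc)) (vanish z<s))
                                       (sumBelow-last B (f ∘ suc) (vanish ∘ s<s))

shift : (ℕ → ℕ) → ℕ → ℕ
shift f zero    = 0
shift f (suc m) = f m

shift-cong : ∀ m {f g : ℕ → ℕ} → (∀ k → f k ≡ g k) → shift f m ≡ shift g m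
shift-cong zero    eq = refl
shift-cong (suc m) eq = eq m

shift-zero : ∀ m {f : ℕ → ℕ} → (∀ k → f k ≡ 0) → shift f m ≡ 0
shift-zero zero    vanish = refl
shift-zero (suc m) vanish = vanish m

binomialSum : ℕ → ℕ → ℕ → ℕ
binomialSum p q m = sum (map (λ k → (p C k) * (q C (m ∸ 2 * k))) (upTo (suc (m / 2))))

binomialSum-sumBelow : ∀ p q m →
  binomialSum p q m ≡ sumBelow (suc (m / 2)) (λ k → (p C k) * (q C (m ∸ 2 * k)))
binomialSum-sumBelow p q m = cong sum (map-applyUpTo (λ k → k) _ (suc (m / 2)))

k≤m/2⇒2*k≤m : ∀ {k} m → k ≤ m / 2 → 2 * k ≤ m
k≤m/2⇒2*k≤m m k≤m/2 =
  ≤-trans (*-monoʳ-≤ 2 k≤m/2) (subst (_≤ m) (*-comm (m / 2) 2) (m/n*n≤m m 2))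

2*k≤m⇒k≤m/2 : ∀ {k} m → 2 * k ≤ m → k ≤ m / 2
2*k≤m⇒k≤m/2 {k} m 2k≤m =
  subst (_≤ m / 2) (m*n/n≡m k 2) (/-monoˡ-≤ 2 (subst (_≤ m) (*-comm 2 k) 2k≤m))

module _ (p q : ℕ) where

  -- The cut-off at 2k > m is essential: there m ∸ 2k = 0 and q C 0 = 1.
  term : ℕ → ℕ → ℕ
  term m k with 2 * k ≤? m
  ... | yes _ = (p C k) * (q C (m ∸ 2 * k))
  ... | no  _ = 0

  term-≤ : ∀ {m} k → 2 * k ≤ m → term m k ≡ (p C k) * (q C (m ∸ 2 * k))
  term-≤ {m} k 2k≤m with 2 * k ≤? m
  ... | yes _    = refl
  ... | no  2k≰m = contradiction 2k≤m 2k≰m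

  term-> : ∀ {m k} → m < k → term m k ≡ 0
  term-> {m} {k} m<k with 2 * k ≤? m
  ... | yes 2k≤m = contradiction (≤-trans m<k (≤-trans (m≤m+n k _) 2k≤m)) (n≮n m)
  ... | no  _    = refl

  truncatedSum : ℕ → ℕ
  truncatedSum m = sumBelow (suc m) (term m)

  truncatedSum-extend : ∀ {m B} → suc m ≤ B → sumBelow B (term m) ≡ truncatedSum m
  truncatedSum-extend suc-m≤B = sumBelow-vanishing (term _) suc-m≤B term->

  binomialSum≡truncatedSum : ∀ m → binomialSum p q m ≡ truncatedSum m
  binomialSum≡truncatedSum m = begin
    binomialSum p q m
      ≡⟨ binomialSum-sumBelow p q m ⟩
    sumBelow (suc (m / 2)) (λ k → (p C k) * (q C (m ∸ 2 * k)))
      ≡⟨ sumBelow-cong (suc (m / 2)) (λ {k} k≤m/2 → term-≤ k (k≤m/2⇒2*k≤m m (≤-pred k≤m/2))) ⟨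
    sumBelow (suc (m / 2)) (term m)
      ≡⟨ sumBelow-vanishing (term m) (s≤s (m/n≤m m 2)) beyond ⟨
    truncatedSum m ∎
    where
    beyond : ∀ {k} → suc (m / 2) ≤ k → term m k ≡ 0
    beyond {k} m/2<k with 2 * k ≤? m
    ... | yes 2k≤m = contradiction (2*k≤m⇒k≤m/2 m 2k≤m) (<⇒≱ m/2<k)
    ... | no  _    = refl

term-Pascalᵣ : ∀ p q m k → term p (suc q) (suc m) k ≡ term p q m k + term p q (suc m) k
term-Pascalᵣ p q m k with 2 * k ≤? m | 2 * k ≤? suc m
... | yes 2k≤m | yes _ = begin
  (p C k) * (suc q C (suc m ∸ 2 * k))
    ≡⟨ cong (λ j → (p C k) * (suc q C j)) (+-∸-assoc 1 2k≤m) ⟩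
  (p C k) * (suc q C suc (m ∸ 2 * k))
    ≡⟨ cong ((p C k) *_) (nCk+nC[k+1]≡[n+1]C[k+1] q (m ∸ 2 * k)) ⟨
  (p C k) * (q C (m ∸ 2 * k) + q C suc (m ∸ 2 * k))
    ≡⟨ *-distribˡ-+ (p C k) _ _ ⟩
  (p C k) * (q C (m ∸ 2 * k)) + (p C k) * (q C suc (m ∸ 2 * k))
    ≡⟨ cong (λ j → (p C k) * (q C (m ∸ 2 * k)) + (p C k) * (q C j)) (+-∸-assoc 1 2k≤m) ⟨
  (p C k) * (q C (m ∸ 2 * k)) + (p C k) * (q C (suc m ∸ 2 * k)) ∎
... | yes 2k≤m | no 2k≰1+m = contradiction (m≤n⇒m≤1+n 2k≤m) 2k≰1+m
... | no 2k≰m  | yes _     = begin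
  (p C k) * (suc q C (suc m ∸ 2 * k)) ≡⟨ cong (λ j → (p C k) * (suc q C j)) 1+m∸2k≡0 ⟩
  (p C k) * 1                         ≡⟨ cong (λ j → (p C k) * (q C j)) 1+m∸2k≡0 ⟨
  (p C k) * (q C (suc m ∸ 2 * k))     ∎
  where
  1+m∸2k≡0 : suc m ∸ 2 * k ≡ 0
  1+m∸2k≡0 = m≤n⇒m∸n≡0 (≰⇒> 2k≰m)
... | no _     | no _      = refl

term-Pascalₗ : ∀ p q m j →
  term (suc p) q (suc (suc m)) (suc j) ≡ term p q m j + term p q (suc (suc m)) (suc j)
term-Pascalₗ p q m j with 2 * j ≤? m | 2 * suc j ≤? suc (suc m)
... | yes 2j≤m | yes _ = begin
  (suc p C suc j) * (q C (suc (suc m) ∸ 2 * suc j))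
    ≡⟨ cong (λ i → (suc p C suc j) * (q C i)) 2+m∸2[1+j]≡m∸2j ⟩
  (suc p C suc j) * (q C (m ∸ 2 * j))
    ≡⟨ cong (_* (q C (m ∸ 2 * j))) (nCk+nC[k+1]≡[n+1]C[k+1] p j) ⟨
  (p C j + p C suc j) * (q C (m ∸ 2 * j))
    ≡⟨ *-distribʳ-+ _ (p C j) (p C suc j) ⟩
  (p C j) * (q C (m ∸ 2 * j)) + (p C suc j) * (q C (m ∸ 2 * j))
    ≡⟨ cong (λ i → (p C j) * (q C (m ∸ 2 * j)) + (p C suc j) * (q C i)) 2+m∸2[1+j]≡m∸2j ⟨
  (p C j) * (q C (m ∸ 2 * j)) + (p C suc j) * (q C (suc (suc m) ∸ 2 * suc j)) ∎
  where
  2+m∸2[1+j]≡m∸2j : suc (suc m) ∸ 2 * suc j ≡ m ∸ 2 * j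
  2+m∸2[1+j]≡m∸2j = cong (suc (suc m) ∸_) (*-suc 2 j)
... | yes 2j≤m | no 2j+2≰m+2 =
  contradiction (subst (_≤ suc (suc m)) (sym (*-suc 2 j)) (s≤s (s≤s 2j≤m))) 2j+2≰m+2
... | no 2j≰m  | yes 2j+2≤m+2 =
  contradiction (≤-pred (≤-pred (subst (_≤ suc (suc m)) (*-suc 2 j) 2j+2≤m+2))) 2j≰m
... | no _     | no _ = refl

truncatedSum-Pascalᵣ : ∀ p q m →
  truncatedSum p (suc q) (suc m) ≡ truncatedSum p q m + truncatedSum p q (suc m)
truncatedSum-Pascalᵣ p q m = begin
  sumBelow (suc (suc m)) (term p (suc q) (suc m))
    ≡⟨ sumBelow-cong (suc (suc m)) (λ {k} _ → term-Pascalᵣ p q m k) ⟩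
  sumBelow (suc (suc m)) (λ k → term p q m k + term p q (suc m) k)
    ≡⟨ sumBelow-+ (suc (suc m)) (term p q m) (term p q (suc m)) ⟩
  sumBelow (suc (suc m)) (term p q m) + truncatedSum p q (suc m)
    ≡⟨ cong (_+ truncatedSum p q (suc m)) (truncatedSum-extend p q (n≤1+n (suc m))) ⟩
  truncatedSum p q m + truncatedSum p q (suc m) ∎

truncatedSum-Pascalₗ : ∀ p q m →
  truncatedSum (suc p) q (suc (suc m)) ≡ truncatedSum p q m + truncatedSum p q (suc (suc m))
truncatedSum-Pascalₗ p q m = begin
  term p q (suc (suc m)) 0 + sumBelow (suc (suc m)) (term (suc p) q (suc (suc m)) ∘ suc)
    ≡⟨ cong (λ s → term p q (suc (suc m)) 0 + s) (begin
      sumBelow (suc (suc m)) (term (suc p) q (suc (suc m)) ∘ suc)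
        ≡⟨ sumBelow-cong (suc (suc m)) (λ {j} _ → term-Pascalₗ p q m j) ⟩
      sumBelow (suc (suc m)) (λ j → term p q m j + term p q (suc (suc m)) (suc j))
        ≡⟨ sumBelow-+ (suc (suc m)) (term p q m) (term p q (suc (suc m)) ∘ suc) ⟩
      sumBelow (suc (suc m)) (term p q m) + rest
        ≡⟨ cong (_+ rest) (truncatedSum-extend p q (n≤1+n (suc m))) ⟩
      truncatedSum p q m + rest ∎) ⟩
  term p q (suc (suc m)) 0 + (truncatedSum p q m + rest)
    ≡⟨ x∙yz≈y∙xz (term p q (suc (suc m)) 0) (truncatedSum p q m) rest ⟩
  truncatedSum p q m + truncatedSum p q (suc (suc m)) ∎
  where
  rest = sumBelow (suc (suc m)) (term p q (suc (suc m)) ∘ suc)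

binomialSum-fixedPoint : ∀ p q m →
  binomialSum p (suc q) m ≡ shift (binomialSum p q) m + binomialSum p q m
binomialSum-fixedPoint p q zero    = refl
binomialSum-fixedPoint p q (suc m) = begin
  binomialSum p (suc q) (suc m)
    ≡⟨ binomialSum≡truncatedSum p (suc q) (suc m) ⟩
  truncatedSum p (suc q) (suc m)
    ≡⟨ truncatedSum-Pascalᵣ p q m ⟩
  truncatedSum p q m + truncatedSum p q (suc m)
    ≡⟨ cong₂ _+_ (binomialSum≡truncatedSum p q m) (binomialSum≡truncatedSum p q (suc m)) ⟨
  binomialSum p q m + binomialSum p q (suc m) ∎

binomialSum-orbit : ∀ p q m →
  binomialSum (suc p) q m ≡ shift (shift (binomialSum p q)) m + binomialSum p q m
binomialSum-orbit p q zero          = refl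
binomialSum-orbit p q (suc zero)    = refl
binomialSum-orbit p q (suc (suc m)) = begin
  binomialSum (suc p) q (suc (suc m))
    ≡⟨ binomialSum≡truncatedSum (suc p) q (suc (suc m)) ⟩
  truncatedSum (suc p) q (suc (suc m))
    ≡⟨ truncatedSum-Pascalₗ p q m ⟩
  truncatedSum p q m + truncatedSum p q (suc (suc m))
    ≡⟨ cong₂ _+_ (binomialSum≡truncatedSum p q m) (binomialSum≡truncatedSum p q (suc (suc m))) ⟨
  binomialSum p q m + binomialSum p q (suc (suc m)) ∎

binomialSum-empty : ∀ m → binomialSum 0 0 (suc m) ≡ 0
binomialSum-empty m = trans (binomialSum-sumBelow 0 0 (suc m)) (sumBelow-zero _ vanish)
  where
  vanish : ∀ {k} → k < suc (suc m / 2) → (0 C k) * (0 C (suc m ∸ 2 * k)) ≡ 0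
  vanish {zero}  _ = refl
  vanish {suc k} _ = refl

noFixedPoints-summand≡0 : ∀ p k {m} → 2 * k < m → (p C k) * (0 C (m ∸ 2 * k)) ≡ 0
noFixedPoints-summand≡0 p k 2k<m =
  trans (cong ((p C k) *_) (k>n⇒nCk≡0 (m<n⇒0<n∸m 2k<m))) (*-zeroʳ (p C k))

even⇒≡2*half : ∀ m → m % 2 ≡ 0 → m ≡ 2 * (m / 2)
even⇒≡2*half m even = begin
  m                 ≡⟨ m≡m%n+[m/n]*n m 2 ⟩
  m % 2 + m / 2 * 2 ≡⟨ cong (_+ m / 2 * 2) even ⟩
  m / 2 * 2         ≡⟨ *-comm (m / 2) 2 ⟩
  2 * (m / 2)       ∎

binomialSum-even : ∀ p m → m % 2 ≡ 0 → binomialSum p 0 m ≡ p C (m / 2)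
binomialSum-even p m even = begin
  binomialSum p 0 m
    ≡⟨ binomialSum-sumBelow p 0 m ⟩
  sumBelow (suc (m / 2)) (λ k → (p C k) * (0 C (m ∸ 2 * k)))
    ≡⟨ sumBelow-last (m / 2) _ (λ {k} k<m/2 → noFixedPoints-summand≡0 p k (2k<m k<m/2)) ⟩
  (p C (m / 2)) * (0 C (m ∸ 2 * (m / 2)))
    ≡⟨ cong (λ i → (p C (m / 2)) * (0 C (i ∸ 2 * (m / 2)))) (even⇒≡2*half m even) ⟩
  (p C (m / 2)) * (0 C (2 * (m / 2) ∸ 2 * (m / 2)))
    ≡⟨ cong (λ i → (p C (m / 2)) * (0 C i)) (n∸n≡0 (2 * (m / 2))) ⟩
  (p C (m / 2)) * 1
    ≡⟨ *-identityʳ (p C (m / 2)) ⟩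
  p C (m / 2) ∎
  where
  2k<m : ∀ {k} → k < m / 2 → 2 * k < m
  2k<m k<m/2 = <-≤-trans (*-monoʳ-< 2 k<m/2) (≤-reflexive (sym (even⇒≡2*half m even)))

binomialSum-odd : ∀ p m → m % 2 ≡ 1 → binomialSum p 0 m ≡ 0
binomialSum-odd p m odd = trans (binomialSum-sumBelow p 0 m) (sumBelow-zero (suc (m / 2))
  (λ {k} k≤m/2 → noFixedPoints-summand≡0 p k (2k<m k≤m/2)))
  where
  2k≢m : ∀ k → 2 * k ≢ m
  2k≢m k 2k≡m = 0≢1+n (begin
    0               ≡⟨ m*n%n≡0 k 2 ⟨
    (k * 2) % 2     ≡⟨ cong (_% 2) (trans (*-comm k 2) 2k≡m) ⟩
    m % 2           ≡⟨ odd ⟩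
    1               ∎)
  2k<m : ∀ {k} → k < suc (m / 2) → 2 * k < m
  2k<m {k} k≤m/2 = ≤∧≢⇒< (k≤m/2⇒2*k≤m m (≤-pred k≤m/2)) (2k≢m k)

𝟙 : ∀ {ℓ} {P : Set ℓ} → Dec P → ℕ
𝟙 d = if does d then 1 else 0

module _ {ℓ} {P : Set ℓ} where

  𝟙-yes : P → (d : Dec P) → 𝟙 d ≡ 1
  𝟙-yes p (yes _) = refl
  𝟙-yes p (no ¬p) = contradiction p ¬p

  𝟙-no : ¬ P → (d : Dec P) → 𝟙 d ≡ 0
  𝟙-no ¬p (yes p) = contradiction p ¬p
  𝟙-no ¬p (no _)  = refl

module _ {ℓ ℓ′} {P : Set ℓ} {Q : Set ℓ′} where

  𝟙-cong : P ⇔ Q → (d : Dec P) (e : Dec Q) → 𝟙 d ≡ 𝟙 e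
  𝟙-cong P⇔Q (yes p) e = sym (𝟙-yes (Equivalence.to P⇔Q p) e)
  𝟙-cong P⇔Q (no ¬p) e = sym (𝟙-no (¬p ∘ Equivalence.from P⇔Q) e)

  𝟙-× : (d : Dec P) (e : Dec Q) → 𝟙 (d ×-dec e) ≡ 𝟙 d * 𝟙 e
  𝟙-× (yes _) (yes _) = refl
  𝟙-× (yes _) (no _)  = refl
  𝟙-× (no _)  _       = refl

∈-tabulate : ∀ {p} {P : Fin n → Set p} (P? : ∀ x → Dec (P x)) {x} →
             x ∈ tabulate (λ x → does (P? x)) ⇔ P x
∈-tabulate P? {x} = mk⇔
  (λ x∈ → dec-true⁻¹ (P? x) (trans (sym (lookup∘tabulate _ x)) ([]=⇒lookup x∈)))
  (λ Px → lookup⇒[]= x _ (trans (lookup∘tabulate _ x) (dec-true (P? x) Px)))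
  where
  dec-true⁻¹ : ∀ {p} {P : Set p} (d : Dec P) → does d ≡ true → P
  dec-true⁻¹ (yes p) _  = p
  dec-true⁻¹ (no _)  ()

length-filter-allFin : ∀ {p} {P : Fin n → Set p} (P? : ∀ x → Dec (P x)) →
  length (filter P? (allFin n)) ≡ ∣ tabulate (λ x → does (P? x)) ∣
length-filter-allFin P? = go _ (λ x → x)
  where
  go : ∀ k (f : Fin k → Fin _) →
       length (filter P? (List.tabulate f)) ≡ ∣ tabulate (λ x → does (P? (f x))) ∣
  go zero    f = refl
  go (suc k) f with P? (f zero)
  ... | yes _ = cong suc (go k (f ∘ suc))
  ... | no  _ = go k (f ∘ suc)

insert : Fin n → Subset n → Subset n
insert y Ω = Ω [ y ]≔ inside

delete : Fin n → Subset n → Subset n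
delete y T = T [ y ]≔ outside

x∈insert⁻ : ∀ {x y : Fin n} {Ω} → x ∈ insert y Ω → x ≡ y ⊎ x ∈ Ω
x∈insert⁻ {x = zero}  {zero}  {_ ∷ _} here      = inj₁ refl
x∈insert⁻ {x = zero}  {suc _} {_ ∷ _} here      = inj₂ here
x∈insert⁻ {x = suc _} {zero}  {_ ∷ _} (there p) = inj₂ (there p)
x∈insert⁻ {x = suc _} {suc _} {_ ∷ _} (there p) = Sum.map (cong suc) there (x∈insert⁻ p)

y∈insert : ∀ (y : Fin n) Ω → y ∈ insert y Ω
y∈insert zero    (_ ∷ _) = here
y∈insert (suc y) (_ ∷ Ω) = there (y∈insert y Ω)

x∈insert⁺ : ∀ {x : Fin n} y {Ω} → x ∈ Ω → x ∈ insert y Ω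
x∈insert⁺ zero    here      = here
x∈insert⁺ (suc y) here      = here
x∈insert⁺ zero    (there p) = there p
x∈insert⁺ (suc y) (there p) = there (x∈insert⁺ y p)

x∈delete⁻ : ∀ {x y : Fin n} {T} → x ∈ delete y T → x ∈ T × x ≢ y
x∈delete⁻ {x = zero}  {zero}  {_ ∷ _} ()
x∈delete⁻ {x = zero}  {suc _} {_ ∷ _} here      = here , λ ()
x∈delete⁻ {x = suc _} {zero}  {_ ∷ _} (there p) = there p , λ ()
x∈delete⁻ {x = suc _} {suc _} {_ ∷ _} (there p) =
  let x∈T , x≢y = x∈delete⁻ p in there x∈T , x≢y ∘ Fin.suc-injective

x∈delete⁺ : ∀ {x y : Fin n} {T} → x ∈ T → x ≢ y → x ∈ delete y T
x∈delete⁺ {x = x} {y} {T} x∈T x≢y = []≔-minimal T x y x≢y x∈T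

y∉delete : ∀ (y : Fin n) {T} → y ∉ delete y T
y∉delete y y∈T′ = proj₂ (x∈delete⁻ y∈T′) refl

insert-⊆-delete : ∀ {y : Fin n} {Ω T} → y ∈ T → y ∉ Ω → insert y Ω ⊆ T ⇔ Ω ⊆ delete y T
insert-⊆-delete {y = y} y∈T y∉Ω = mk⇔
  (λ yΩ⊆T {x} x∈Ω → x∈delete⁺ (yΩ⊆T (x∈insert⁺ y x∈Ω)) (λ { refl → y∉Ω x∈Ω }))
  (λ Ω⊆T′ {x} x∈yΩ →
     [ (λ { refl → y∈T }) , (λ x∈Ω → proj₁ (x∈delete⁻ (Ω⊆T′ x∈Ω))) ]′ (x∈insert⁻ x∈yΩ))

⊆-delete : ∀ {y : Fin n} {Ω T} → y ∉ Ω → Ω ⊆ T ⇔ Ω ⊆ delete y T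
⊆-delete y∉Ω = mk⇔
  (λ Ω⊆T {x} x∈Ω → x∈delete⁺ (Ω⊆T x∈Ω) (λ { refl → y∉Ω x∈Ω }))
  (λ Ω⊆T′ {x} x∈Ω → proj₁ (x∈delete⁻ (Ω⊆T′ x∈Ω)))

∣insert∣ : ∀ {y : Fin n} {Ω} → y ∉ Ω → ∣ insert y Ω ∣ ≡ suc ∣ Ω ∣
∣insert∣ {y = zero}  {outside ∷ Ω} y∉Ω = refl
∣insert∣ {y = zero}  {inside  ∷ Ω} y∉Ω = contradiction here y∉Ω
∣insert∣ {y = suc y} {outside ∷ Ω} y∉Ω = ∣insert∣ (y∉Ω ∘ there)
∣insert∣ {y = suc y} {inside  ∷ Ω} y∉Ω = cong suc (∣insert∣ (y∉Ω ∘ there))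

∣insert∣≡1+⇔ : ∀ {y : Fin n} {Ω m} → y ∉ Ω → ∣ insert y Ω ∣ ≡ suc m ⇔ ∣ Ω ∣ ≡ m
∣insert∣≡1+⇔ y∉Ω = mk⇔ (λ eq → suc-injective (trans (sym (∣insert∣ y∉Ω)) eq))
                        (λ eq → trans (∣insert∣ y∉Ω) (cong suc eq))

∣delete∣ : ∀ {y : Fin n} {T} → y ∈ T → ∣ T ∣ ≡ suc ∣ delete y T ∣
∣delete∣ here                     = refl
∣delete∣ {T = outside ∷ _} (there p) = ∣delete∣ p
∣delete∣ {T = inside  ∷ _} (there p) = cong suc (∣delete∣ p)

delete-∉ : ∀ {y : Fin n} {T} → y ∉ T → delete y T ≡ T
delete-∉ {y = zero}  {outside ∷ T} y∉T = refl
delete-∉ {y = zero}  {inside  ∷ T} y∉T = contradiction here y∉T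
delete-∉ {y = suc y} {s ∷ T}       y∉T = cong (s ∷_) (delete-∉ (y∉T ∘ there))

delete-∩ : ∀ (y : Fin n) T A → delete y T ∩ A ≡ delete y (T ∩ A)
delete-∩ zero    (_ ∷ T) (_ ∷ A) = refl
delete-∩ (suc y) (_ ∷ T) (_ ∷ A) = cong (_ ∷_) (delete-∩ y T A)

∣p∣≡0⇒x∉p : ∀ {p : Subset n} {x} → ∣ p ∣ ≡ 0 → x ∉ p
∣p∣≡0⇒x∉p {p = outside ∷ p} eq (there x∈p) = ∣p∣≡0⇒x∉p eq x∈p

∣p∣≡1+k⇒nonempty : ∀ {p : Subset n} → ∣ p ∣ ≡ suc k → Nonempty p
∣p∣≡1+k⇒nonempty {p = inside  ∷ p} eq = zero , here
∣p∣≡1+k⇒nonempty {p = outside ∷ p} eq = let x , x∈p = ∣p∣≡1+k⇒nonempty eq in suc x , there x∈p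

sumSubsets : ∀ n → (Subset n → ℕ) → ℕ
sumSubsets zero    F = F []
sumSubsets (suc n) F = sumSubsets n (F ∘ (inside ∷_)) + sumSubsets n (F ∘ (outside ∷_))

sumSubsets-cong : ∀ n {F G : Subset n → ℕ} → (∀ Ω → F Ω ≡ G Ω) → sumSubsets n F ≡ sumSubsets n G
sumSubsets-cong zero    eq = eq []
sumSubsets-cong (suc n) eq =
  cong₂ _+_ (sumSubsets-cong n (eq ∘ (inside ∷_))) (sumSubsets-cong n (eq ∘ (outside ∷_)))

sumSubsets-zero : ∀ n {F : Subset n → ℕ} → (∀ Ω → F Ω ≡ 0) → sumSubsets n F ≡ 0
sumSubsets-zero zero    eq = eq []
sumSubsets-zero (suc n) eq =
  cong₂ _+_ (sumSubsets-zero n (eq ∘ (inside ∷_))) (sumSubsets-zero n (eq ∘ (outside ∷_)))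

sumSubsets-+ : ∀ n (F G : Subset n → ℕ) →
               sumSubsets n (λ Ω → F Ω + G Ω) ≡ sumSubsets n F + sumSubsets n G
sumSubsets-+ zero    F G = refl
sumSubsets-+ (suc n) F G = trans
  (cong₂ _+_ (sumSubsets-+ n (F ∘ (inside ∷_)) (G ∘ (inside ∷_)))
             (sumSubsets-+ n (F ∘ (outside ∷_)) (G ∘ (outside ∷_))))
  (interchange (sumSubsets n (F ∘ (inside ∷_))) (sumSubsets n (G ∘ (inside ∷_)))
               (sumSubsets n (F ∘ (outside ∷_))) (sumSubsets n (G ∘ (outside ∷_))))

sumSubsets-shift : ∀ n (F : ℕ → Subset n → ℕ) m →
  sumSubsets n (λ Ω → shift (λ k → F k Ω) m) ≡ shift (λ k → sumSubsets n (F k)) m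
sumSubsets-shift n F zero    = sumSubsets-zero n (λ _ → refl)
sumSubsets-shift n F (suc m) = refl

sumSubsets-shift² : ∀ n (F : ℕ → Subset n → ℕ) m →
  sumSubsets n (λ Ω → shift (shift (λ k → F k Ω)) m) ≡ shift (shift (λ k → sumSubsets n (F k))) m
sumSubsets-shift² n F m = trans (sumSubsets-shift n (λ k Ω → shift (λ j → F j Ω) k) m)
                                (shift-cong m (sumSubsets-shift n F))

sumSubsets-⊥ : ∀ n (F : Subset n → ℕ) → (∀ {x} Ω → x ∈ Ω → F Ω ≡ 0) → sumSubsets n F ≡ F ⊥
sumSubsets-⊥ zero    F vanish = refl
sumSubsets-⊥ (suc n) F vanish = cong₂ _+_
  (sumSubsets-zero n (λ Ω → vanish (inside ∷ Ω) here))
  (sumSubsets-⊥ n (F ∘ (outside ∷_)) (λ Ω x∈Ω → vanish (outside ∷ Ω) (there x∈Ω)))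

ifAbsent : Fin n → Subset n → ℕ → ℕ
ifAbsent y Ω t = if does (y ∈? Ω) then 0 else t

ifAbsent-∈ : ∀ {y : Fin n} {Ω} t → y ∈ Ω → ifAbsent y Ω t ≡ 0
ifAbsent-∈ {y = y} {Ω} t y∈Ω = cong (if_then 0 else t) (dec-true (y ∈? Ω) y∈Ω)

ifAbsent-∉ : ∀ {y : Fin n} {Ω} t → y ∉ Ω → ifAbsent y Ω t ≡ t
ifAbsent-∉ {y = y} {Ω} t y∉Ω = cong (if_then 0 else t) (dec-false (y ∈? Ω) y∉Ω)

sumSubsets-split : ∀ n (y : Fin n) (F : Subset n → ℕ) →
  sumSubsets n F ≡ sumSubsets n (λ Ω → ifAbsent y Ω (F (insert y Ω) + F Ω))
sumSubsets-split (suc n) zero F = sym (cong₂ _+_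
  (sumSubsets-zero n (λ _ → refl))
  (sumSubsets-+ n (F ∘ (inside ∷_)) (F ∘ (outside ∷_))))
sumSubsets-split (suc n) (suc y) F =
  cong₂ _+_ (sumSubsets-split n y (F ∘ (inside ∷_))) (sumSubsets-split n y (F ∘ (outside ∷_)))

-- Subsets closed under an involution

module Involution {n} (ι : Fin n → Fin n) (ι-involutive : ∀ x → ι (ι x) ≡ x) where

  Closed : Subset n → Set
  Closed Ω = ∀ {x} → x ∈ Ω → ι x ∈ Ω

  closed? : ∀ Ω → Dec (Closed Ω)
  closed? Ω = map′ (λ closed {x} → closed x) (λ closed x → closed)
                   (Fin.all? (λ x → x ∈? Ω →-dec ι x ∈? Ω))

  fixedPoints : Subset n
  fixedPoints = tabulate (λ x → does (ι x Fin.≟ x))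

  ∈fixedPoints⁺ : ∀ {x} → ι x ≡ x → x ∈ fixedPoints
  ∈fixedPoints⁺ = Equivalence.from (∈-tabulate (λ x → ι x Fin.≟ x))

  ∈fixedPoints⁻ : ∀ {x} → x ∈ fixedPoints → ι x ≡ x
  ∈fixedPoints⁻ = Equivalence.to (∈-tabulate (λ x → ι x Fin.≟ x))

  numFixedPoints : Subset n → ℕ
  numFixedPoints T = ∣ T ∩ fixedPoints ∣

  ClosedSubset : Subset n → ℕ → Subset n → Set
  ClosedSubset T m Ω = Ω ⊆ T × Closed Ω × ∣ Ω ∣ ≡ m

  closedSubset? : ∀ T m Ω → Dec (ClosedSubset T m Ω)
  closedSubset? T m Ω = Ω ⊆? T ×-dec closed? Ω ×-dec ∣ Ω ∣ ≟ m

  χ : Subset n → ℕ → Subset n → ℕ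
  χ T m Ω = 𝟙 (closedSubset? T m Ω)

  numClosedSubsets : Subset n → ℕ → ℕ
  numClosedSubsets T m = sumSubsets n (χ T m)

  χ-split : Fin n → Subset n → ℕ → Subset n → ℕ
  χ-split y T m Ω = ifAbsent y Ω (χ T m (insert y Ω) + χ T m Ω)

  χ-⇔ : ∀ {T m Ω T′ m′ Ω′} → ClosedSubset T m Ω ⇔ ClosedSubset T′ m′ Ω′ → χ T m Ω ≡ χ T′ m′ Ω′
  χ-⇔ {T} {m} {Ω} {T′} {m′} {Ω′} equiv =
    𝟙-cong equiv (closedSubset? T m Ω) (closedSubset? T′ m′ Ω′)

  χ-no : ∀ {T m Ω} → ¬ ClosedSubset T m Ω → χ T m Ω ≡ 0
  χ-no {T} {m} {Ω} ¬closedSubset = 𝟙-no ¬closedSubset (closedSubset? T m Ω)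

  χ-delete : ∀ {y T m Ω} → y ∉ Ω → χ T m Ω ≡ χ (delete y T) m Ω
  χ-delete y∉Ω = χ-⇔ (⊆-delete y∉Ω ×-⇔ ⇔-id _)

  χ-∉ : ∀ {y T m Ω} → y ∉ T → y ∈ Ω → χ T m Ω ≡ 0
  χ-∉ y∉T y∈Ω = χ-no (λ (Ω⊆T , _) → y∉T (Ω⊆T y∈Ω))

  Invariant : (Fin n → Set) → Set
  Invariant D = ∀ {x} → D x → D (ι x)

  closed-adjoin : ∀ {D : Fin n → Set} {Ω W} → Invariant D → (∀ {x} → D x → x ∉ Ω) →
                  (∀ {x} → x ∈ W → x ∈ Ω ⊎ D x) → (∀ {x} → x ∈ Ω ⊎ D x → x ∈ W) →
                  Closed W ⇔ Closed Ω
  closed-adjoin {D} {Ω} {W} invariant disjoint W⁻ W⁺ = mk⇔ restrict extend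
    where
    restrict : Closed W → Closed Ω
    restrict closedW {x} x∈Ω with W⁻ (closedW (W⁺ (inj₁ x∈Ω)))
    ... | inj₁ ιx∈Ω = ιx∈Ω
    ... | inj₂ Dιx  = contradiction x∈Ω (disjoint (subst D (ι-involutive x) (invariant Dιx)))
    extend : Closed Ω → Closed W
    extend closedΩ x∈W =
      W⁺ ([ (λ x∈Ω → inj₁ (closedΩ x∈Ω)) , (λ Dx → inj₂ (invariant Dx)) ]′ (W⁻ x∈W))

  closed-remove : ∀ {D : Fin n → Set} {T T′} → Invariant D → Closed T →
                  (∀ {x} → x ∈ T′ → x ∈ T × ¬ D x) → (∀ {x} → x ∈ T → ¬ D x → x ∈ T′) →
                  Closed T′
  closed-remove {D} invariant closedT T′⁻ T′⁺ {x} x∈T′ =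
    let x∈T , ¬Dx = T′⁻ x∈T′ in
    T′⁺ (closedT x∈T) (λ Dιx → ¬Dx (subst D (ι-involutive x) (invariant Dιx)))

  insert-open : ∀ {y Ω} → ι y ≢ y → ι y ∉ Ω → ¬ Closed (insert y Ω)
  insert-open ιy≢y ιy∉Ω closed = [ ιy≢y , ιy∉Ω ]′ (x∈insert⁻ (closed (y∈insert _ _)))

  Orbit : Fin n → Fin n → Set
  Orbit y x = x ≡ y ⊎ x ≡ ι y

  orbit-invariant : ∀ {y} → Invariant (Orbit y)
  orbit-invariant (inj₁ refl) = inj₂ refl
  orbit-invariant (inj₂ refl) = inj₁ (ι-involutive _)

  closed-deleteOrbit : ∀ {y T} → Closed T → Closed (delete (ι y) (delete y T))
  closed-deleteOrbit closedT = closed-remove orbit-invariant closedT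
    (λ x∈T″ → let x∈T′ , x≢ιy = x∈delete⁻ x∈T″ ; x∈T , x≢y = x∈delete⁻ x∈T′ in
              x∈T , [ x≢y , x≢ιy ]′)
    (λ x∈T ¬orbit → x∈delete⁺ (x∈delete⁺ x∈T (¬orbit ∘ inj₁)) (¬orbit ∘ inj₂))

  numFixedPoints-unfixed : ∀ {y} T → ι y ≢ y → numFixedPoints (delete y T) ≡ numFixedPoints T
  numFixedPoints-unfixed {y} T unfixed = cong ∣_∣ (trans (delete-∩ y T fixedPoints)
    (delete-∉ (unfixed ∘ ∈fixedPoints⁻ ∘ proj₂ ∘ x∈p∩q⁻ T fixedPoints)))

  module _ {y T} (y∈T : y ∈ T) (fixed : ι y ≡ y) where

    private
      T′ : Subset n
      T′ = delete y T

    closed-deleteFixed : Closed T → Closed T′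
    closed-deleteFixed closedT =
      closed-remove {D = _≡ y} (λ { refl → fixed }) closedT x∈delete⁻ x∈delete⁺

    numFixedPoints-fixedPoint : numFixedPoints T ≡ suc (numFixedPoints T′)
    numFixedPoints-fixedPoint = begin
      ∣ T ∩ fixedPoints ∣
        ≡⟨ ∣delete∣ (x∈p∩q⁺ (y∈T , ∈fixedPoints⁺ fixed)) ⟩
      suc ∣ delete y (T ∩ fixedPoints) ∣
        ≡⟨ cong (suc ∘ ∣_∣) (delete-∩ y T fixedPoints) ⟨
      suc ∣ T′ ∩ fixedPoints ∣ ∎

    closedSubset-insertFixed : ∀ {m Ω} → y ∉ Ω →
      ClosedSubset T (suc m) (insert y Ω) ⇔ ClosedSubset T′ m Ω
    closedSubset-insertFixed {Ω = Ω} y∉Ω =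
      insert-⊆-delete y∈T y∉Ω ×-⇔ closedness ×-⇔ ∣insert∣≡1+⇔ y∉Ω
      where
      closedness : Closed (insert y Ω) ⇔ Closed Ω
      closedness = closed-adjoin {D = _≡ y} (λ { refl → fixed }) (λ { refl → y∉Ω })
        (λ x∈yΩ → [ inj₂ , inj₁ ]′ (x∈insert⁻ x∈yΩ))
        [ x∈insert⁺ y , (λ { refl → y∈insert y Ω }) ]′

    χ-split-fixedPoint : ∀ m {Ω} → Dec (y ∈ Ω) →
      χ-split y T m Ω ≡ shift (λ k → χ T′ k Ω) m + χ T′ m Ω
    χ-split-fixedPoint m (yes y∈Ω) = trans (ifAbsent-∈ _ y∈Ω)
      (sym (cong₂ _+_ (shift-zero m (λ _ → χ-∉ (y∉delete y) y∈Ω)) (χ-∉ (y∉delete y) y∈Ω)))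
    χ-split-fixedPoint m {Ω} (no y∉Ω) =
      trans (ifAbsent-∉ _ y∉Ω) (cong₂ _+_ (inserted m) (χ-delete y∉Ω))
      where
      inserted : ∀ m → χ T m (insert y Ω) ≡ shift (λ k → χ T′ k Ω) m
      inserted zero    = χ-no {Ω = insert y Ω}
        (λ (_ , _ , size) → 1+n≢0 (trans (sym (∣insert∣ y∉Ω)) size))
      inserted (suc m) = χ-⇔ (closedSubset-insertFixed y∉Ω)

    numClosedSubsets-fixedPoint : ∀ m →
      numClosedSubsets T m ≡ shift (numClosedSubsets T′) m + numClosedSubsets T′ m
    numClosedSubsets-fixedPoint m = begin
      sumSubsets n (χ T m)
        ≡⟨ sumSubsets-split n y (χ T m) ⟩
      sumSubsets n (χ-split y T m)
        ≡⟨ sumSubsets-cong n (λ Ω → χ-split-fixedPoint m (y ∈? Ω)) ⟩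
      sumSubsets n (λ Ω → shift (λ k → χ T′ k Ω) m + χ T′ m Ω)
        ≡⟨ sumSubsets-+ n _ (χ T′ m) ⟩
      sumSubsets n (λ Ω → shift (λ k → χ T′ k Ω) m) + numClosedSubsets T′ m
        ≡⟨ cong (_+ numClosedSubsets T′ m) (sumSubsets-shift n (χ T′) m) ⟩
      shift (numClosedSubsets T′) m + numClosedSubsets T′ m ∎

  module _ {y T} (y∈T : y ∈ T) (ιy∈T : ι y ∈ T) (unfixed : ι y ≢ y) where

    private
      z : Fin n
      z = ι y

      T″ : Subset n
      T″ = delete z (delete y T)

      y∉T″ : y ∉ T″
      y∉T″ y∈T″ = y∉delete y (proj₁ (x∈delete⁻ y∈T″))

      y∉insert-z : ∀ {Ω} → y ∉ Ω → y ∉ insert z Ω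
      y∉insert-z y∉Ω y∈zΩ = [ unfixed ∘ sym , y∉Ω ]′ (x∈insert⁻ y∈zΩ)

      outside-T″ : ∀ m {w Ω} → w ∉ T″ → w ∈ Ω → shift (shift (λ k → χ T″ k Ω)) m + χ T″ m Ω ≡ 0
      outside-T″ m w∉T″ w∈Ω =
        cong₂ _+_ (shift-zero m (λ k → shift-zero k (λ _ → χ-∉ w∉T″ w∈Ω))) (χ-∉ w∉T″ w∈Ω)

    ∣T∣≡2+∣T″∣ : ∣ T ∣ ≡ suc (suc ∣ T″ ∣)
    ∣T∣≡2+∣T″∣ = trans (∣delete∣ y∈T) (cong suc (∣delete∣ (x∈delete⁺ ιy∈T unfixed)))

    closedSubset-insertOrbit : ∀ {m Ω} → y ∉ Ω → z ∉ Ω →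
      ClosedSubset T (suc (suc m)) (insert y (insert z Ω)) ⇔ ClosedSubset T″ m Ω
    closedSubset-insertOrbit {Ω = Ω} y∉Ω z∉Ω =
      (insert-⊆-delete (x∈delete⁺ ιy∈T unfixed) z∉Ω ⇔-∘ insert-⊆-delete y∈T (y∉insert-z y∉Ω))
      ×-⇔ closed-adjoin orbit-invariant disjoint W⁻ W⁺
      ×-⇔ (∣insert∣≡1+⇔ z∉Ω ⇔-∘ ∣insert∣≡1+⇔ (y∉insert-z y∉Ω))
      where
      disjoint : ∀ {x} → Orbit y x → x ∉ Ω
      disjoint (inj₁ refl) = y∉Ω
      disjoint (inj₂ refl) = z∉Ω
      W⁻ : ∀ {x} → x ∈ insert y (insert z Ω) → x ∈ Ω ⊎ Orbit y x
      W⁻ x∈W with x∈insert⁻ x∈W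
      ... | inj₁ x≡y  = inj₂ (inj₁ x≡y)
      ... | inj₂ x∈zΩ = [ inj₂ ∘ inj₂ , inj₁ ]′ (x∈insert⁻ x∈zΩ)
      W⁺ : ∀ {x} → x ∈ Ω ⊎ Orbit y x → x ∈ insert y (insert z Ω)
      W⁺ (inj₁ x∈Ω)         = x∈insert⁺ y (x∈insert⁺ z x∈Ω)
      W⁺ (inj₂ (inj₁ refl)) = y∈insert y _
      W⁺ (inj₂ (inj₂ refl)) = x∈insert⁺ y (y∈insert z Ω)

    -- Of the four sets Ω ∪ E with E ⊆ {y, ι y}, only E = ∅ and E = {y, ι y} can be closed.
    χ-split-orbit : ∀ m {Ω} → Dec (z ∈ Ω) → Dec (y ∈ Ω) →
      ifAbsent z Ω (χ-split y T m (insert z Ω) + χ-split y T m Ω) ≡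
      shift (shift (λ k → χ T″ k Ω)) m + χ T″ m Ω
    χ-split-orbit m (yes z∈Ω) _ = trans (ifAbsent-∈ _ z∈Ω) (sym (outside-T″ m (y∉delete z) z∈Ω))
    χ-split-orbit m {Ω} (no z∉Ω) (yes y∈Ω) = begin
      ifAbsent z Ω (χ-split y T m (insert z Ω) + χ-split y T m Ω)
        ≡⟨ ifAbsent-∉ _ z∉Ω ⟩
      χ-split y T m (insert z Ω) + χ-split y T m Ω
        ≡⟨ cong₂ _+_ (ifAbsent-∈ _ (x∈insert⁺ z y∈Ω)) (ifAbsent-∈ _ y∈Ω) ⟩
      0
        ≡⟨ outside-T″ m y∉T″ y∈Ω ⟨
      shift (shift (λ k → χ T″ k Ω)) m + χ T″ m Ω ∎
    χ-split-orbit m {Ω} (no z∉Ω) (no y∉Ω) = begin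
      ifAbsent z Ω (χ-split y T m (insert z Ω) + χ-split y T m Ω)
        ≡⟨ ifAbsent-∉ _ z∉Ω ⟩
      χ-split y T m (insert z Ω) + χ-split y T m Ω
        ≡⟨ cong₂ _+_ (ifAbsent-∉ _ (y∉insert-z y∉Ω)) (ifAbsent-∉ _ y∉Ω) ⟩
      (χ T m (insert y (insert z Ω)) + χ T m (insert z Ω)) + (χ T m (insert y Ω) + χ T m Ω)
        ≡⟨ cong₂ _+_ (cong₂ _+_ (inserted m) (χ-no (insert-open ιz≢z ιz∉Ω ∘ proj₁ ∘ proj₂)))
                     (cong₂ _+_ (χ-no (insert-open unfixed z∉Ω ∘ proj₁ ∘ proj₂))
                                (trans (χ-delete y∉Ω) (χ-delete z∉Ω))) ⟩
      (shift (shift (λ k → χ T″ k Ω)) m + 0) + (0 + χ T″ m Ω)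
        ≡⟨ cong (_+ χ T″ m Ω) (+-identityʳ _) ⟩
      shift (shift (λ k → χ T″ k Ω)) m + χ T″ m Ω ∎
      where
      ιz≢z : ι z ≢ z
      ιz≢z ιz≡z = unfixed (trans (sym ιz≡z) (ι-involutive y))
      ιz∉Ω : ι z ∉ Ω
      ιz∉Ω = y∉Ω ∘ subst (_∈ Ω) (ι-involutive y)
      ∣yzΩ∣ : ∣ insert y (insert z Ω) ∣ ≡ suc (suc ∣ Ω ∣)
      ∣yzΩ∣ = trans (∣insert∣ (y∉insert-z y∉Ω)) (cong suc (∣insert∣ z∉Ω))
      inserted : ∀ m → χ T m (insert y (insert z Ω)) ≡ shift (shift (λ k → χ T″ k Ω)) m
      inserted zero          = χ-no {Ω = insert y (insert z Ω)}
        (λ (_ , _ , size) → 1+n≢0 (trans (sym ∣yzΩ∣) size))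
      inserted (suc zero)    = χ-no {Ω = insert y (insert z Ω)}
        (λ (_ , _ , size) → 1+n≢0 (suc-injective (trans (sym ∣yzΩ∣) size)))
      inserted (suc (suc m)) = χ-⇔ (closedSubset-insertOrbit y∉Ω z∉Ω)

    numClosedSubsets-orbit : ∀ m →
      numClosedSubsets T m ≡ shift (shift (numClosedSubsets T″)) m + numClosedSubsets T″ m
    numClosedSubsets-orbit m = begin
      sumSubsets n (χ T m)
        ≡⟨ sumSubsets-split n y (χ T m) ⟩
      sumSubsets n (χ-split y T m)
        ≡⟨ sumSubsets-split n z (χ-split y T m) ⟩
      sumSubsets n (λ Ω → ifAbsent z Ω (χ-split y T m (insert z Ω) + χ-split y T m Ω))
        ≡⟨ sumSubsets-cong n (λ Ω → χ-split-orbit m (z ∈? Ω) (y ∈? Ω)) ⟩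
      sumSubsets n (λ Ω → shift (shift (λ k → χ T″ k Ω)) m + χ T″ m Ω)
        ≡⟨ sumSubsets-+ n _ (χ T″ m) ⟩
      sumSubsets n (λ Ω → shift (shift (λ k → χ T″ k Ω)) m) + numClosedSubsets T″ m
        ≡⟨ cong (_+ numClosedSubsets T″ m) (sumSubsets-shift² n (χ T″) m) ⟩
      shift (shift (numClosedSubsets T″)) m + numClosedSubsets T″ m ∎

  record OrbitCount (T : Subset n) : Set where
    field
      pairs                        : ℕ
      size-decomposition           : ∣ T ∣ ≡ 2 * pairs + numFixedPoints T
      numClosedSubsets≡binomialSum : ∀ m →
        numClosedSubsets T m ≡ binomialSum pairs (numFixedPoints T) m

  orbitCount-empty : ∀ {T} → ∣ T ∣ ≡ 0 → OrbitCount T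
  orbitCount-empty {T} ∣T∣≡0 = record
    { pairs                        = 0
    ; size-decomposition           = trans ∣T∣≡0 (sym noFixedPoints)
    ; numClosedSubsets≡binomialSum = λ m → begin
        numClosedSubsets T m
          ≡⟨ sumSubsets-⊥ n (χ T m) (λ _ → χ-∉ (∣p∣≡0⇒x∉p ∣T∣≡0)) ⟩
        χ T m ⊥
          ≡⟨ onlyEmpty m ⟩
        binomialSum 0 0 m
          ≡⟨ cong (λ q → binomialSum 0 q m) noFixedPoints ⟨
        binomialSum 0 (numFixedPoints T) m ∎
    }
    where
    noFixedPoints : numFixedPoints T ≡ 0
    noFixedPoints = n≤0⇒n≡0 (≤-trans (∣p∩q∣≤∣p∣ T fixedPoints) (≤-reflexive ∣T∣≡0))
    onlyEmpty : ∀ m → χ T m ⊥ ≡ binomialSum 0 0 m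
    onlyEmpty zero    = 𝟙-yes empty (closedSubset? T 0 ⊥)
      where
      empty : ClosedSubset T 0 ⊥
      empty = ⊆-min T , ⊥-elim ∘ ∉⊥ , ∣⊥∣≡0 n
    onlyEmpty (suc m) = trans (χ-no {Ω = ⊥} (λ (_ , _ , size) → 1+n≢0 (trans (sym size) (∣⊥∣≡0 n))))
                              (sym (binomialSum-empty m))

  orbitCount-fixedPoint : ∀ {y T} → y ∈ T → ι y ≡ y → OrbitCount (delete y T) → OrbitCount T
  orbitCount-fixedPoint {y} {T} y∈T fixed count′ = record
    { pairs                        = p
    ; size-decomposition           = begin
        ∣ T ∣                    ≡⟨ ∣delete∣ y∈T ⟩
        suc ∣ delete y T ∣        ≡⟨ cong suc size-decomposition ⟩
        suc (2 * p + q′)         ≡⟨ +-suc (2 * p) q′ ⟨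
        2 * p + suc q′           ≡⟨ cong (λ q → 2 * p + q) (numFixedPoints-fixedPoint y∈T fixed) ⟨
        2 * p + numFixedPoints T ∎
    ; numClosedSubsets≡binomialSum = λ m → begin
        numClosedSubsets T m
          ≡⟨ numClosedSubsets-fixedPoint y∈T fixed m ⟩
        shift (numClosedSubsets (delete y T)) m + numClosedSubsets (delete y T) m
          ≡⟨ cong₂ _+_ (shift-cong m numClosedSubsets≡binomialSum)
                       (numClosedSubsets≡binomialSum m) ⟩
        shift (binomialSum p q′) m + binomialSum p q′ m
          ≡⟨ binomialSum-fixedPoint p q′ m ⟨
        binomialSum p (suc q′) m
          ≡⟨ cong (λ q → binomialSum p q m) (numFixedPoints-fixedPoint y∈T fixed) ⟨
        binomialSum p (numFixedPoints T) m ∎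
    }
    where
    open OrbitCount count′ renaming (pairs to p)
    q′ = numFixedPoints (delete y T)

  orbitCount-orbit : ∀ {y T} → y ∈ T → ι y ∈ T → ι y ≢ y →
                     OrbitCount (delete (ι y) (delete y T)) → OrbitCount T
  orbitCount-orbit {y} {T} y∈T ιy∈T unfixed count″ = record
    { pairs                        = suc p
    ; size-decomposition           = begin
        ∣ T ∣                  ≡⟨ ∣T∣≡2+∣T″∣ y∈T ιy∈T unfixed ⟩
        suc (suc ∣ T″ ∣)        ≡⟨ cong (λ s → suc (suc s)) size-decomposition ⟩
        suc (suc (2 * p + q″)) ≡⟨ cong (_+ q″) (*-suc 2 p) ⟨
        2 * suc p + q″         ≡⟨ cong (λ q → 2 * suc p + q) q″≡q ⟩
        2 * suc p + q          ∎
    ; numClosedSubsets≡binomialSum = λ m → begin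
        numClosedSubsets T m
          ≡⟨ numClosedSubsets-orbit y∈T ιy∈T unfixed m ⟩
        shift (shift (numClosedSubsets T″)) m + numClosedSubsets T″ m
          ≡⟨ cong₂ _+_ (shift-cong m (λ k → shift-cong k numClosedSubsets≡binomialSum))
                       (numClosedSubsets≡binomialSum m) ⟩
        shift (shift (binomialSum p q″)) m + binomialSum p q″ m
          ≡⟨ binomialSum-orbit p q″ m ⟨
        binomialSum (suc p) q″ m
          ≡⟨ cong (λ q → binomialSum (suc p) q m) q″≡q ⟩
        binomialSum (suc p) q m ∎
    }
    where
    T″ = delete (ι y) (delete y T)
    open OrbitCount count″ renaming (pairs to p)
    q = numFixedPoints T
    q″ = numFixedPoints T″
    q″≡q : q″ ≡ q
    q″≡q = trans (numFixedPoints-unfixed (delete y T) ιιy≢ιy) (numFixedPoints-unfixed T unfixed)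
      where
      ιιy≢ιy : ι (ι y) ≢ ι y
      ιιy≢ιy ιιy≡ιy = unfixed (trans (sym ιιy≡ιy) (ι-involutive y))

  orbitCount : ∀ {T} → Closed T → OrbitCount T
  orbitCount {T} = <-rec (λ k → ∀ {T} → ∣ T ∣ ≡ k → Closed T → OrbitCount T) step ∣ T ∣ refl
    where
    step : ∀ k → (∀ {j} → j < k → ∀ {T} → ∣ T ∣ ≡ j → Closed T → OrbitCount T) →
           ∀ {T} → ∣ T ∣ ≡ k → Closed T → OrbitCount T
    step zero    _            ∣T∣≡0   _       = orbitCount-empty ∣T∣≡0
    step (suc k) smallerCount {T} ∣T∣≡1+k closedT
      with y , y∈T ← ∣p∣≡1+k⇒nonempty ∣T∣≡1+k | ι y Fin.≟ y
    ... | yes fixed  = orbitCount-fixedPoint y∈T fixed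
      (smallerCount (≤-reflexive (trans (sym (∣delete∣ y∈T)) ∣T∣≡1+k)) refl
                    (closed-deleteFixed y∈T fixed closedT))
    ... | no unfixed = orbitCount-orbit y∈T (closedT y∈T) unfixed
      (smallerCount (m<n⇒m<1+n (≤-reflexive (suc-injective
                      (trans (sym (∣T∣≡2+∣T″∣ y∈T (closedT y∈T) unfixed)) ∣T∣≡1+k)))) refl
                    (closed-deleteOrbit closedT))

  fixedPointFree⇒even : (∀ x → ι x ≢ x) → n % 2 ≡ 0
  fixedPointFree⇒even fixedPointFree = begin
    n % 2                              ≡⟨ cong (_% 2) (∣⊤∣≡n n) ⟨
    ∣ ⊤ {n} ∣ % 2                      ≡⟨ cong (_% 2) size-decomposition ⟩
    (2 * pairs + numFixedPoints ⊤) % 2 ≡⟨ cong (λ q → (2 * pairs + q) % 2) noFixedPoints ⟩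
    (2 * pairs + 0) % 2                ≡⟨ cong (_% 2) (trans (+-identityʳ _) (*-comm 2 pairs)) ⟩
    (pairs * 2) % 2                    ≡⟨ m*n%n≡0 pairs 2 ⟩
    0                                  ∎
    where
    open OrbitCount (orbitCount {⊤} (λ _ → ∈⊤))
    noFixedPoints : numFixedPoints ⊤ ≡ 0
    noFixedPoints = trans (cong ∣_∣ (Empty-unique λ (x , x∈⊤∩F) →
      fixedPointFree x (∈fixedPoints⁻ (proj₂ (x∈p∩q⁻ ⊤ fixedPoints x∈⊤∩F))))) (∣⊥∣≡0 n)

module _ {a} {A : Set a} where

  sumℤ-cast : ∀ (f : A → ℕ) xs → sumℤ (map (+_ ∘ f) xs) ≡ + sum (map f xs)
  sumℤ-cast f []       = refl
  sumℤ-cast f (x ∷ xs) = cong (+ f x +ℤ_) (sumℤ-cast f xs)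

  sumℤ-zero : ∀ {f : A → ℤ} xs → (∀ x → f x ≡ + 0) → sumℤ (map f xs) ≡ + 0
  sumℤ-zero []       vanish = refl
  sumℤ-zero (x ∷ xs) vanish = cong₂ _+ℤ_ (vanish x) (sumℤ-zero xs vanish)

  sumℤ-+ : ∀ (f g : A → ℤ) xs →
           sumℤ (map (λ x → f x +ℤ g x) xs) ≡ sumℤ (map f xs) +ℤ sumℤ (map g xs)
  sumℤ-+ f g []       = refl
  sumℤ-+ f g (x ∷ xs) = trans (cong (f x +ℤ g x +ℤ_) (sumℤ-+ f g xs))
                              (+ℤ-interchange (f x) (g x) (sumℤ (map f xs)) (sumℤ (map g xs)))

  sumℤ-*ˡ : ∀ c (f : A → ℤ) xs → sumℤ (map (λ x → c *ℤ f x) xs) ≡ c *ℤ sumℤ (map f xs)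
  sumℤ-*ˡ c f []       = sym (ℤ.*-zeroʳ c)
  sumℤ-*ˡ c f (x ∷ xs) = trans (cong (c *ℤ f x +ℤ_) (sumℤ-*ˡ c f xs))
                               (sym (ℤ.*-distribˡ-+ c (f x) (sumℤ (map f xs))))

  sumℤ-filter : ∀ {p} {P : Pred A p} (P? : Decidable P) (f : A → ℤ) xs →
    sumℤ (map f (filter P? xs)) ≡ sumℤ (map (λ x → + 𝟙 (P? x) *ℤ f x) xs)
  sumℤ-filter P? f [] = refl
  sumℤ-filter P? f (x ∷ xs) with P? x
  ... | yes _ = cong₂ _+ℤ_ (sym (ℤ.*-identityˡ (f x))) (sumℤ-filter P? f xs)
  ... | no  _ = trans (sumℤ-filter P? f xs) (sym (ℤ.+-identityˡ _))

  length-filter≡sum𝟙 : ∀ {p} {P : Pred A p} (P? : Decidable P) xs →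
    length (filter P? xs) ≡ sum (map (𝟙 ∘ P?) xs)
  length-filter≡sum𝟙 P? []       = refl
  length-filter≡sum𝟙 P? (x ∷ xs) with P? x
  ... | yes _ = cong suc (length-filter≡sum𝟙 P? xs)
  ... | no  _ = length-filter≡sum𝟙 P? xs

sumℤ-swap : ∀ {a b} {A : Set a} {B : Set b} (F : A → B → ℤ) xs ys →
  sumℤ (map (λ x → sumℤ (map (F x) ys)) xs) ≡ sumℤ (map (λ y → sumℤ (map (λ x → F x y) xs)) ys)
sumℤ-swap F []       ys = sym (sumℤ-zero ys (λ _ → refl))
sumℤ-swap F (x ∷ xs) ys = begin
  sumℤ (map (F x) ys) +ℤ sumℤ (map (λ x → sumℤ (map (F x) ys)) xs)
    ≡⟨ cong (sumℤ (map (F x) ys) +ℤ_) (sumℤ-swap F xs ys) ⟩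
  sumℤ (map (F x) ys) +ℤ sumℤ (map (λ y → sumℤ (map (λ x → F x y) xs)) ys)
    ≡⟨ sumℤ-+ (F x) (λ y → sumℤ (map (λ x → F x y) xs)) ys ⟨
  sumℤ (map (λ y → sumℤ (map (λ x → F x y) (x ∷ xs))) ys) ∎

sum-allSubsets : ∀ n (F : Subset n → ℕ) → sum (map F (allSubsets n)) ≡ sumSubsets n F
sum-allSubsets zero    F = +-identityʳ (F [])
sum-allSubsets (suc n) F = begin
  sum (map F (map (inside ∷_) (allSubsets n) ++ map (outside ∷_) (allSubsets n)))
    ≡⟨ cong sum (map-++ F (map (inside ∷_) (allSubsets n)) _) ⟩
  sum (map F (map (inside ∷_) (allSubsets n)) ++ map F (map (outside ∷_) (allSubsets n)))
    ≡⟨ sum-++ (map F (map (inside ∷_) (allSubsets n))) _ ⟩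
  sum (map F (map (inside ∷_) (allSubsets n))) + sum (map F (map (outside ∷_) (allSubsets n)))
    ≡⟨ cong₂ (λ xs ys → sum xs + sum ys) (map-∘ (allSubsets n)) (map-∘ (allSubsets n)) ⟨
  sum (map (F ∘ (inside ∷_)) (allSubsets n)) + sum (map (F ∘ (outside ∷_)) (allSubsets n))
    ≡⟨ cong₂ _+_ (sum-allSubsets n (F ∘ (inside ∷_))) (sum-allSubsets n (F ∘ (outside ∷_))) ⟩
  sumSubsets (suc n) F ∎

∈allSubsets : ∀ {n} (Ω : Subset n) → Ω List.∈ allSubsets n
∈allSubsets []            = here refl
∈allSubsets (inside  ∷ Ω) = ∈-++⁺ˡ (∈-map⁺ (inside ∷_) (∈allSubsets Ω))
∈allSubsets (outside ∷ Ω) = ∈-++⁺ʳ _ (∈-map⁺ (outside ∷_) (∈allSubsets Ω))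

allSubsets-unique : ∀ n → Unique.Unique (allSubsets n)
allSubsets-unique zero    = All.[] AllPairs.∷ AllPairs.[]
allSubsets-unique (suc n) = Unique.++⁺
  (Unique.map⁺ (λ { refl → refl }) (allSubsets-unique n))
  (Unique.map⁺ (λ { refl → refl }) (allSubsets-unique n))
  (λ (Ω∈ins , Ω∈outs) →
     let _ , _ , Ω≡inside∷  = ∈-map⁻ (inside ∷_) Ω∈ins
         _ , _ , Ω≡outside∷ = ∈-map⁻ (outside ∷_) Ω∈outs
     in  inside≢outside (cong Vec.head (trans (sym Ω≡inside∷) Ω≡outside∷)))
  where
  inside≢outside : inside ≢ outside
  inside≢outside ()

-- Cayley graphs of a finite abelian group

module Cayley {n} (G : FinAbGroup n) where

  open FinAbGroup G
  open IsAbelianGroup isAbelianGroup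
    using (assoc; comm; identityˡ; identityʳ; inverseˡ; inverseʳ; isGroup)

  group : Group _ _
  group = record { isGroup = isGroup }

  open GroupProperties group using (⁻¹-involutive; inverseˡ-unique; identityʳ-unique; ε⁻¹≈ε)
  open Involution _⁻¹ ⁻¹-involutive

  equivalent⇒≡ : ∀ {Ω Ω′} → Equivalent G Ω Ω′ → Ω ≡ Ω′
  equivalent⇒≡ {Ω} {Ω′} (f , adjacent , equivariant) = ⊆-antisym Ω⊆Ω′ Ω′⊆Ω
    where
    open Bijection f using (to)
    fromε : ∀ x → ε ⁻¹ ∙ x ≡ x
    fromε x = trans (cong (_∙ x) ε⁻¹≈ε) (identityˡ x)
    translated : ∀ x → to ε ⁻¹ ∙ to x ≡ x
    translated x = begin
      to ε ⁻¹ ∙ to x         ≡⟨ cong (λ u → to ε ⁻¹ ∙ to u) (identityʳ x) ⟨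
      to ε ⁻¹ ∙ to (x ∙ ε)   ≡⟨ cong (to ε ⁻¹ ∙_) (trans (equivariant x ε) (comm x (to ε))) ⟩
      to ε ⁻¹ ∙ (to ε ∙ x)   ≡⟨ assoc (to ε ⁻¹) (to ε) x ⟨
      to ε ⁻¹ ∙ to ε ∙ x     ≡⟨ cong (_∙ x) (inverseˡ (to ε)) ⟩
      ε ∙ x                  ≡⟨ identityˡ x ⟩
      x                      ∎
    Ω⊆Ω′ : Ω ⊆ Ω′
    Ω⊆Ω′ {x} x∈Ω = subst (_∈ Ω′) (translated x)
      (proj₁ (adjacent ε x) (subst (_∈ Ω) (sym (fromε x)) x∈Ω))
    Ω′⊆Ω : Ω′ ⊆ Ω
    Ω′⊆Ω {x} x∈Ω′ = subst (_∈ Ω) (fromε x)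
      (proj₂ (adjacent ε x) (subst (_∈ Ω′) (sym (translated x)) x∈Ω′))

  equivalent-refl : ∀ Ω → Equivalent G Ω Ω
  equivalent-refl Ω = ⤖-id (Fin n) , (λ _ _ → (λ adj → adj) , (λ adj → adj)) , (λ _ _ → refl)

  private
    subgroup⁺ : ∀ {S} → IsSubgroup G S → S List.∈ subgroups G
    subgroup⁺ {S} = ∈-filter⁺ (isSubgroup? G) (∈allSubsets S)

    subgroup⁻ : ∀ {S} → S List.∈ subgroups G → IsSubgroup G S
    subgroup⁻ = proj₂ ∘ ∈-filter⁻ (isSubgroup? G) {xs = allSubsets n}

    allSubgroups : All (IsSubgroup G) (subgroups G)
    allSubgroups = all-filter (isSubgroup? G) (allSubsets n)

  InEverySubgroupAbove : Subset n → Fin n → Set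
  InEverySubgroupAbove Ω x = ∀ S → IsSubgroup G S → Ω ⊆ S → x ∈ S

  inEverySubgroupAbove? : ∀ Ω x → Dec (InEverySubgroupAbove Ω x)
  inEverySubgroupAbove? Ω x =
    map′ (λ all S → All.lookup all ∘ subgroup⁺) (λ above → All.tabulate (above _ ∘ subgroup⁻))
         (All.all? (λ S → Ω ⊆? S →-dec x ∈? S) (subgroups G))

  span : Subset n → Subset n
  span Ω = tabulate (λ x → does (inEverySubgroupAbove? Ω x))

  ∈span⁻ : ∀ {Ω x} → x ∈ span Ω → InEverySubgroupAbove Ω x
  ∈span⁻ {Ω} = Equivalence.to (∈-tabulate (inEverySubgroupAbove? Ω))

  ∈span⁺ : ∀ {Ω x} → InEverySubgroupAbove Ω x → x ∈ span Ω
  ∈span⁺ {Ω} = Equivalence.from (∈-tabulate (inEverySubgroupAbove? Ω))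

  span-isSubgroup : ∀ Ω → IsSubgroup G (span Ω)
  span-isSubgroup Ω =
      ∈span⁺ (λ _ (ε∈S , _) _ → ε∈S)
    , (λ x y x∈ y∈ → ∈span⁺ λ S S≤G@(_ , ∙-closed , _) Ω⊆S →
                       ∙-closed x y (∈span⁻ x∈ S S≤G Ω⊆S) (∈span⁻ y∈ S S≤G Ω⊆S))
    , (λ x x∈ → ∈span⁺ λ S S≤G@(_ , _ , ⁻¹-closed) Ω⊆S → ⁻¹-closed x (∈span⁻ x∈ S S≤G Ω⊆S))

  ⊆span : ∀ Ω → Ω ⊆ span Ω
  ⊆span Ω x∈Ω = ∈span⁺ (λ _ _ Ω⊆S → Ω⊆S x∈Ω)

  generates? : ∀ Ω → Dec (Generates G Ω)
  generates? Ω = map′ (λ span≡⊤ S S≤G Ω⊆S g → ∈span⁻ (span≡⊤ g) S S≤G Ω⊆S)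
                      (λ generates g → ∈span⁺ (λ S S≤G Ω⊆S → generates S S≤G Ω⊆S g))
                      (Fin.all? (_∈? span Ω))

  upSum-span : ∀ μ Ω → upSum G μ Ω ≡ upSum G μ (span Ω)
  upSum-span μ Ω = begin
    upSum G μ Ω
      ≡⟨ sumℤ-filter (Ω ⊆?_) μ (subgroups G) ⟩
    sumℤ (map (λ S → + 𝟙 (Ω ⊆? S) *ℤ μ S) (subgroups G))
      ≡⟨ cong sumℤ (map-cong-local (All.map sameSubgroupsAbove allSubgroups)) ⟩
    sumℤ (map (λ S → + 𝟙 (span Ω ⊆? S) *ℤ μ S) (subgroups G))
      ≡⟨ sumℤ-filter (span Ω ⊆?_) μ (subgroups G) ⟨
    upSum G μ (span Ω) ∎
    where
    sameSubgroupsAbove : ∀ {S} → IsSubgroup G S → + 𝟙 (Ω ⊆? S) *ℤ μ S ≡ + 𝟙 (span Ω ⊆? S) *ℤ μ S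
    sameSubgroupsAbove {S} S≤G =
      cong (λ k → + k *ℤ μ S) (𝟙-cong (mk⇔ span⊆ (⊆-trans (⊆span Ω))) (Ω ⊆? S) (span Ω ⊆? S))
      where
      span⊆ : Ω ⊆ S → span Ω ⊆ S
      span⊆ Ω⊆S x∈span = ∈span⁻ x∈span S S≤G Ω⊆S

  upSum≡𝟙generates : ∀ {μ} → IsMobius G μ → ∀ Ω → upSum G μ Ω ≡ + 𝟙 (generates? Ω)
  upSum≡𝟙generates {μ} (top , below) Ω = trans (upSum-span μ Ω) (bySpan (generates? Ω))
    where
    bySpan : Dec (Generates G Ω) → upSum G μ (span Ω) ≡ + 𝟙 (generates? Ω)
    bySpan (yes generates) = begin
      upSum G μ (span Ω) ≡⟨ cong (upSum G μ) span≡⊤ ⟩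
      upSum G μ ⊤        ≡⟨ top ⟩
      + 1                ≡⟨ cong +_ (𝟙-yes generates (generates? Ω)) ⟨
      + 𝟙 (generates? Ω) ∎
      where
      span≡⊤ : span Ω ≡ ⊤
      span≡⊤ = ⊆-antisym (λ _ → ∈⊤) (λ {x} _ → ∈span⁺ (λ S S≤G Ω⊆S → generates S S≤G Ω⊆S x))
    bySpan (no ¬generates) = begin
      upSum G μ (span Ω) ≡⟨ below (span Ω) (span-isSubgroup Ω) span≢⊤ ⟩
      + 0                ≡⟨ cong +_ (𝟙-no ¬generates (generates? Ω)) ⟨
      + 𝟙 (generates? Ω) ∎
      where
      span≢⊤ : span Ω ≢ ⊤
      span≢⊤ span≡⊤ = ¬generates λ S S≤G Ω⊆S g → ∈span⁻ (subst (g ∈_) (sym span≡⊤) ∈⊤) S S≤G Ω⊆S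

  mobius-inversion : ∀ {μ} → IsMobius G μ → ∀ (w : Subset n → ℤ) →
    sumℤ (map (λ Ω → w Ω *ℤ + 𝟙 (generates? Ω)) (allSubsets n)) ≡
    sumℤ (map (λ S → μ S *ℤ sumℤ (map (λ Ω → + 𝟙 (Ω ⊆? S) *ℤ w Ω) (allSubsets n))) (subgroups G))
  mobius-inversion {μ} mobius w = begin
    sumℤ (map (λ Ω → w Ω *ℤ + 𝟙 (generates? Ω)) (allSubsets n))
      ≡⟨ cong sumℤ (map-cong (λ Ω → cong (w Ω *ℤ_) (upSum≡𝟙generates mobius Ω)) (allSubsets n)) ⟨
    sumℤ (map (λ Ω → w Ω *ℤ upSum G μ Ω) (allSubsets n))
      ≡⟨ cong sumℤ (map-cong expand (allSubsets n)) ⟩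
    sumℤ (map (λ Ω → sumℤ (map (λ S → w Ω *ℤ (+ 𝟙 (Ω ⊆? S) *ℤ μ S)) (subgroups G))) (allSubsets n))
      ≡⟨ sumℤ-swap (λ Ω S → w Ω *ℤ (+ 𝟙 (Ω ⊆? S) *ℤ μ S)) (allSubsets n) (subgroups G) ⟩
    sumℤ (map (λ S → sumℤ (map (λ Ω → w Ω *ℤ (+ 𝟙 (Ω ⊆? S) *ℤ μ S)) (allSubsets n))) (subgroups G))
      ≡⟨ cong sumℤ (map-cong collect (subgroups G)) ⟩
    sumℤ (map (λ S → μ S *ℤ sumℤ (map (λ Ω → + 𝟙 (Ω ⊆? S) *ℤ w Ω) (allSubsets n))) (subgroups G)) ∎
    where
    expand : ∀ Ω →
      w Ω *ℤ upSum G μ Ω ≡ sumℤ (map (λ S → w Ω *ℤ (+ 𝟙 (Ω ⊆? S) *ℤ μ S)) (subgroups G))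
    expand Ω = trans (cong (w Ω *ℤ_) (sumℤ-filter (Ω ⊆?_) μ (subgroups G)))
                     (sym (sumℤ-*ˡ (w Ω) _ (subgroups G)))
    collect : ∀ S → sumℤ (map (λ Ω → w Ω *ℤ (+ 𝟙 (Ω ⊆? S) *ℤ μ S)) (allSubsets n)) ≡
                    μ S *ℤ sumℤ (map (λ Ω → + 𝟙 (Ω ⊆? S) *ℤ w Ω) (allSubsets n))
    collect S = trans
      (cong sumℤ (map-cong (λ Ω → *ℤ-x∙yz≈z∙yx (w Ω) (+ 𝟙 (Ω ⊆? S)) (μ S)) (allSubsets n)))
      (sumℤ-*ˡ (μ S) (λ Ω → + 𝟙 (Ω ⊆? S) *ℤ w Ω) (allSubsets n))

  Symmetric : ℕ → Subset n → Set
  Symmetric m Ω = (∀ g → g ∈ Ω → (g ⁻¹) ∈ Ω) × ε ∉ Ω × ∣ Ω ∣ ≡ m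

  symmetric? : ∀ m Ω → Dec (Symmetric m Ω)
  symmetric? m Ω = Fin.all? (λ g → g ∈? Ω →-dec (g ⁻¹) ∈? Ω) ×-dec ¬? (ε ∈? Ω) ×-dec ∣ Ω ∣ ≟ m

  connectionSet? : ∀ m Ω → Dec (IsConnectionSet G Ω × ∣ Ω ∣ ≡ m)
  connectionSet? m Ω = map′ (λ ((inv , ε∉ , size) , gen) → (inv , ε∉ , gen) , size)
                            (λ ((inv , ε∉ , gen) , size) → (inv , ε∉ , size) , gen)
                            (symmetric? m Ω ×-dec generates? Ω)

  connectionSets : ℕ → List (Subset n)
  connectionSets m = filter (connectionSet? m) (allSubsets n)

  symmetricIn≡numClosedSubsets : ∀ m S →
    sumℤ (map (λ Ω → + 𝟙 (Ω ⊆? S) *ℤ + 𝟙 (symmetric? m Ω)) (allSubsets n)) ≡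
    + numClosedSubsets (delete ε S) m
  symmetricIn≡numClosedSubsets m S = begin
    sumℤ (map (λ Ω → + 𝟙 (Ω ⊆? S) *ℤ + 𝟙 (symmetric? m Ω)) (allSubsets n))
      ≡⟨ cong sumℤ (map-cong (λ Ω → ℤ.pos-* (𝟙 (Ω ⊆? S)) (𝟙 (symmetric? m Ω))) (allSubsets n)) ⟨
    sumℤ (map (+_ ∘ f) (allSubsets n))
      ≡⟨ sumℤ-cast f (allSubsets n) ⟩
    + sum (map f (allSubsets n))
      ≡⟨ cong +_ (sum-allSubsets n f) ⟩
    + sumSubsets n f
      ≡⟨ cong +_ (sumSubsets-cong n pointwise) ⟩
    + numClosedSubsets (delete ε S) m ∎
    where
    f : Subset n → ℕ
    f Ω = 𝟙 (Ω ⊆? S) * 𝟙 (symmetric? m Ω)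
    equiv : ∀ {Ω} → (Ω ⊆ S × Symmetric m Ω) ⇔ ClosedSubset (delete ε S) m Ω
    equiv = mk⇔
      (λ (Ω⊆S , inv , ε∉Ω , size) →
         (λ x∈Ω → x∈delete⁺ (Ω⊆S x∈Ω) (λ { refl → ε∉Ω x∈Ω })) , inv _ , size)
      (λ (Ω⊆T , closed , size) →
         (proj₁ ∘ x∈delete⁻ ∘ Ω⊆T) , (λ _ → closed) , y∉delete ε ∘ Ω⊆T , size)
    pointwise : ∀ Ω → f Ω ≡ χ (delete ε S) m Ω
    pointwise Ω = trans (sym (𝟙-× (Ω ⊆? S) (symmetric? m Ω)))
      (𝟙-cong equiv (Ω ⊆? S ×-dec symmetric? m Ω) (closedSubset? (delete ε S) m Ω))

  length-connectionSets : ∀ {μ} → IsMobius G μ → ∀ m →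
    + length (connectionSets m) ≡
    sumℤ (map (λ S → μ S *ℤ + numClosedSubsets (delete ε S) m) (subgroups G))
  length-connectionSets {μ} mobius m = begin
    + length (connectionSets m)
      ≡⟨ cong +_ (length-filter≡sum𝟙 (connectionSet? m) (allSubsets n)) ⟩
    + sum (map (𝟙 ∘ connectionSet? m) (allSubsets n))
      ≡⟨ sumℤ-cast (𝟙 ∘ connectionSet? m) (allSubsets n) ⟨
    sumℤ (map (λ Ω → + 𝟙 (connectionSet? m Ω)) (allSubsets n))
      ≡⟨ cong sumℤ (map-cong split (allSubsets n)) ⟩
    sumℤ (map (λ Ω → + 𝟙 (symmetric? m Ω) *ℤ + 𝟙 (generates? Ω)) (allSubsets n))
      ≡⟨ mobius-inversion mobius (λ Ω → + 𝟙 (symmetric? m Ω)) ⟩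
    sumℤ (map (λ S → μ S *ℤ sumℤ (map (λ Ω → + 𝟙 (Ω ⊆? S) *ℤ + 𝟙 (symmetric? m Ω)) (allSubsets n)))
              (subgroups G))
      ≡⟨ cong sumℤ (map-cong (λ S → cong (μ S *ℤ_) (symmetricIn≡numClosedSubsets m S))
                             (subgroups G)) ⟩
    sumℤ (map (λ S → μ S *ℤ + numClosedSubsets (delete ε S) m) (subgroups G)) ∎
    where
    split : ∀ Ω → + 𝟙 (connectionSet? m Ω) ≡ + 𝟙 (symmetric? m Ω) *ℤ + 𝟙 (generates? Ω)
    split Ω = trans (cong +_ (𝟙-× (symmetric? m Ω) (generates? Ω)))
                    (ℤ.pos-* (𝟙 (symmetric? m Ω)) (𝟙 (generates? Ω)))

  o₂≡numFixedPoints : ∀ S → o₂ G S ≡ numFixedPoints (delete ε S)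
  o₂≡numFixedPoints S = trans (length-filter-allFin P?) (cong ∣_∣ (⊆-antisym
    (λ x∈ → let x∈S , xx≡ε , x≢ε = Equivalence.to (∈-tabulate P?) x∈ in
            x∈p∩q⁺ (x∈delete⁺ x∈S x≢ε , ∈fixedPoints⁺ (sym (inverseˡ-unique _ _ xx≡ε))))
    (λ {x} x∈ → let x∈T , x∈F = x∈p∩q⁻ _ _ x∈ ; x∈S , x≢ε = x∈delete⁻ x∈T in
            Equivalence.from (∈-tabulate P?)
              (x∈S , trans (cong (x ∙_) (sym (∈fixedPoints⁻ x∈F))) (inverseʳ x) , x≢ε))))
    where
    P? = λ g → (g ∈? S) ×-dec ((g ∙ g) Fin.≟ ε) ×-dec ¬? (g Fin.≟ ε)

  numInversePairs : Subset n → ℕ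
  numInversePairs S = (∣ S ∣ ∸ o₂ G S ∸ 1) / 2

  numClosedSubsets-subgroup : ∀ {S} → IsSubgroup G S → ∀ m →
    numClosedSubsets (delete ε S) m ≡ binomialSum (numInversePairs S) (o₂ G S) m
  numClosedSubsets-subgroup {S} (ε∈S , _ , ⁻¹-closed) m = begin
    numClosedSubsets T m
      ≡⟨ numClosedSubsets≡binomialSum m ⟩
    binomialSum pairs (numFixedPoints T) m
      ≡⟨ cong₂ (λ p q → binomialSum p q m) pairs≡ (o₂≡numFixedPoints S) ⟨
    binomialSum (numInversePairs S) (o₂ G S) m ∎
    where
    T = delete ε S
    closedT : Closed T
    closedT = closed-remove {D = _≡ ε} (λ { refl → ε⁻¹≈ε }) (⁻¹-closed _) x∈delete⁻ x∈delete⁺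
    open OrbitCount (orbitCount closedT)
    pairs≡ : numInversePairs S ≡ pairs
    pairs≡ = begin
      (∣ S ∣ ∸ o₂ G S ∸ 1) / 2
        ≡⟨ cong₂ (λ s q → (s ∸ q ∸ 1) / 2) (trans (∣delete∣ ε∈S) (cong suc size-decomposition))
                                            (o₂≡numFixedPoints S) ⟩
      (suc (2 * pairs) + numFixedPoints T ∸ numFixedPoints T ∸ 1) / 2
        ≡⟨ cong (λ s → (s ∸ 1) / 2) (m+n∸n≡m (suc (2 * pairs)) (numFixedPoints T)) ⟩
      (2 * pairs) / 2
        ≡⟨ cong (_/ 2) (*-comm 2 pairs) ⟩
      (pairs * 2) / 2
        ≡⟨ m*n/n≡m pairs 2 ⟩
      pairs ∎

  formula≡ : ∀ μ m → formula G μ m ≡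
    sumℤ (map (λ S → μ S *ℤ + binomialSum (numInversePairs S) (o₂ G S) m) (subgroups G))
  formula≡ μ m = trans
    (sumℤ-swap (λ k S → μ S *ℤ + summand S k) (upTo (suc (m / 2))) (subgroups G))
    (cong sumℤ (map-cong (λ S → trans
      (sumℤ-*ˡ (μ S) (λ k → + summand S k) (upTo (suc (m / 2))))
      (cong (μ S *ℤ_) (sumℤ-cast (summand S) (upTo (suc (m / 2))))))
      (subgroups G)))
    where
    summand : Subset n → ℕ → ℕ
    summand S k = (numInversePairs S C k) * (o₂ G S C (m ∸ 2 * k))

  numClasses : ∀ {μ} → IsMobius G μ → ∀ m → NumClasses G m (formula G μ m)
  numClasses {μ} mobius m =
      connectionSets m
    , all-filter (connectionSet? m) (allSubsets n)
    , AllPairs.filter⁺ (connectionSet? m)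
        (AllPairs.map (λ Ω≢Ω′ → Ω≢Ω′ ∘ equivalent⇒≡) (allSubsets-unique n))
    , (λ Ω connection size → Any.map (λ Ω≡Ω′ → subst (Equivalent G Ω) Ω≡Ω′ (equivalent-refl Ω))
                               (∈-filter⁺ (connectionSet? m) (∈allSubsets Ω) (connection , size)))
    , (begin
        + length (connectionSets m)
          ≡⟨ length-connectionSets mobius m ⟩
        sumℤ (map (λ S → μ S *ℤ + numClosedSubsets (delete ε S) m) (subgroups G))
          ≡⟨ cong sumℤ (map-cong-local (All.map (λ S≤G → cong (λ v → μ _ *ℤ + v)
                                   (numClosedSubsets-subgroup S≤G m)) allSubgroups)) ⟩
        sumℤ (map (λ S → μ S *ℤ + binomialSum (numInversePairs S) (o₂ G S) m) (subgroups G))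
          ≡⟨ formula≡ μ m ⟨
        formula G μ m ∎)

  odd⇒noInvolutions : n % 2 ≡ 1 → ∀ g → g ∙ g ≡ ε → g ≡ ε
  odd⇒noInvolutions odd g gg≡ε with g Fin.≟ ε
  ... | yes g≡ε = g≡ε
  ... | no  g≢ε =
    contradiction (trans (sym odd) (Translation.fixedPointFree⇒even fixedPointFree)) (0≢1+n ∘ sym)
    where
    module Translation =
      Involution (_∙ g) (λ x → trans (assoc x g g) (trans (cong (x ∙_) gg≡ε) (identityʳ x)))
    fixedPointFree : ∀ x → x ∙ g ≢ x
    fixedPointFree x xg≡x = g≢ε (identityʳ-unique x g xg≡x)

  odd⇒o₂≡0 : n % 2 ≡ 1 → ∀ S → o₂ G S ≡ 0
  odd⇒o₂≡0 odd S = cong length (filter-none _ (All.universal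
    (λ g (_ , gg≡ε , g≢ε) → g≢ε (odd⇒noInvolutions odd g gg≡ε)) (allFin n)))

  odd⇒binomialSum : n % 2 ≡ 1 → ∀ S m →
    binomialSum (numInversePairs S) (o₂ G S) m ≡ binomialSum ((∣ S ∣ ∸ 1) / 2) 0 m
  odd⇒binomialSum odd S m = cong (λ q → binomialSum ((∣ S ∣ ∸ q ∸ 1) / 2) q m) (odd⇒o₂≡0 odd S)

  formula-odd-even : ∀ μ m → n % 2 ≡ 1 → m % 2 ≡ 0 → formula G μ m ≡ formulaOdd G μ m
  formula-odd-even μ m odd even = trans (formula≡ μ m) (cong sumℤ (map-cong (λ S →
    cong (λ v → μ S *ℤ + v) (trans (odd⇒binomialSum odd S m) (binomialSum-even _ m even)))
    (subgroups G)))

  formula-odd-odd : ∀ μ m → n % 2 ≡ 1 → m % 2 ≡ 1 → formula G μ m ≡ + 0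
  formula-odd-odd μ m odd oddm = trans (formula≡ μ m) (sumℤ-zero (subgroups G) (λ S →
    trans (cong (λ v → μ S *ℤ + v) (trans (odd⇒binomialSum odd S m) (binomialSum-odd _ m oddm)))
          (ℤ.*-zeroʳ (μ S))))

corollary3p5 : ∀ (n : ℕ) (G : FinAbGroup n) (μ : Subset n → ℤ) → IsMobius G μ →
  ∀ (m : ℕ) → 1 ≤ m →
    NumClasses G m (formula G μ m)
    × (n % 2 ≡ 1 →
        (m % 2 ≡ 0 → NumClasses G m (formulaOdd G μ m))
        × (m % 2 ≡ 1 → NumClasses G m (+ 0)))
corollary3p5 n G μ mobius m _ =
    numClasses mobius m
  , λ odd → (λ even → subst (NumClasses G m) (formula-odd-even μ m odd even) (numClasses mobius m))
          , (λ oddm → subst (NumClasses G m) (formula-odd-odd μ m odd oddm) (numClasses mobius m))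
  where open Cayley G
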